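{- Let $G\neq K_2$ be a connected graph belonging to the class $\mathbf{W}_2$. Then: (i) for each $v\in V(G)$ there exist two disjoint sets $S_1,S_2\in\Omega(G)$ with $v\notin S_1\cup S_2$; (ii) $|V(G)|\ge 2\alpha(G)+1$; (iii) for every $u,v\in V(G)$ there is $S\in\Omega(G)$ with $S\cap\{u,v\}=\emptyset$; (iv) $\alpha(G)\le\mu(G)$ and $\alpha(G)+\mu(G)\le|V(G)|-1$; (v) $\alpha(G)=\alpha(G-S)$ for every independent set $S$; (vi) if $A\subseteq B$ and $B$ is independent, then $\partial(A)\le\partial(B)$; (vii) $G$ is regularizable and $|B|<|N(B)|$ for every non-empty independent set $B$; (viii) $|A|\le\alpha(G[N(A)])$ for every independent set $A$; (ix) for every independent set $A$ there exist an independent set $T$ and a matching $M$ such that every vertex of $A$ is matched by $M$ with a vertex of $T$.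
   Context: Graphs are finite, simple, undirected. An independent set is a set of pairwise non-adjacent vertices; $\alpha(G)$ is the maximum size of an independent set and $\Omega(G)$ the family of independent sets of size $\alpha(G)$. A graph belongs to $\mathbf{W}_2$ if every two disjoint independent sets are included, respectively, in two disjoint maximum independent sets. $\mu(G)$ is the maximum size of a matching. For $A\subseteq V(G)$, $N(A)=\{v: N(v)\cap A\neq\emptyset\}$, $G[X]$ is the induced subgraph on $X$, $G-S$ is the subgraph induced by $V(G)\setminus S$, and the differential of $A$ is $\partial(A)=|N(A)\setminus A|-|A|$. A graph is regularizable if, by replacing each edge by a positive integer number of parallel copies, one obtains a regular multigraph of non-zero degree. -}

module Defs where

open import Data.Nat using (ℕ; zero; suc; _⊔_; _<_; _≤_; _<?_)
open import Data.Integer as ℤ using (ℤ; +_)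
open import Data.Bool using (Bool; true; false; _∧_)
open import Data.Bool.Properties using () renaming (_≟_ to _≟ᵇ_)
open import Data.Fin using (Fin; toℕ) renaming (_≟_ to _≟ᶠ_)
open import Data.Fin.Subset using (Subset; _∈_; _∉_; _⊆_; ∣_∣; _─_; inside; outside)
open import Data.Fin.Subset.Properties using (_∈?_; _⊆?_)
open import Data.Fin.Properties using (all?)
open import Data.List using (List; []; _∷_; _++_; map; foldr; filter; length; allFin; concatMap)
open import Data.Bool.ListAction using (any)
open import Data.Nat.ListAction using (sum)
open import Data.List.Relation.Unary.All using (All)
open import Data.List.Relation.Unary.All.Properties using ()
import Data.List.Relation.Unary.Unique.DecPropositional as UniqueDec
open import Data.List.Relation.Unary.All using () renaming (all? to allL?)
open import Data.Product using (Σ; ∃; _×_; _,_; proj₁; proj₂)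
open import Data.Sum using (_⊎_)
open import Data.Vec using (Vec; []; _∷_; tabulate; lookup)
open import Relation.Binary.PropositionalEquality using (_≡_; _≢_)
open import Relation.Nullary using (¬_; Dec)
open import Relation.Nullary.Decidable using (_×-dec_; _→-dec_)

record Graph : Set where
  field
    n      : ℕ
    adj    : Fin n → Fin n → Bool
    sym    : ∀ i j → adj i j ≡ adj j i
    irrefl : ∀ i → adj i i ≡ false
open Graph public

module _ (G : Graph) where

  V : Set
  V = Fin (n G)

  VSet : Set
  VSet = Subset (n G)

  Adj : V → V → Set
  Adj u v = adj G u v ≡ true

  adj? : ∀ u v → Dec (Adj u v)
  adj? u v = adj G u v ≟ᵇ true

  Independent : VSet → Set
  Independent S = ∀ u v → u ∈ S → v ∈ S → ¬ Adj u v

  independent? : ∀ S → Dec (Independent S)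
  independent? S = all? λ u → all? λ v →
    (u ∈? S) →-dec ((v ∈? S) →-dec (adj? u v →-dec Relation.Nullary.Decidable.no (λ ())))
    where import Relation.Nullary.Decidable

  Disjoint : VSet → VSet → Set
  Disjoint S T = ∀ v → v ∈ S → v ∉ T

allSubsets : ∀ k → List (Subset k)
allSubsets zero    = [] ∷ []
allSubsets (suc k) = map (outside ∷_) (allSubsets k) ++ map (inside ∷_) (allSubsets k)

maxOf : List ℕ → ℕ
maxOf = foldr _⊔_ 0

module _ (G : Graph) where

  -- α(G[X]): maximum size of an independent set of G contained in X
  -- (the independent sets of the induced subgraph G[X] are exactly the
  --  independent sets of G contained in X)
  αOn : VSet G → ℕ
  αOn X = maxOf (map ∣_∣ (filter (λ S → independent? G S ×-dec (S ⊆? X)) (allSubsets (n G))))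

  α : ℕ
  α = maxOf (map ∣_∣ (filter (independent? G) (allSubsets (n G))))

  Ω : VSet G → Set
  Ω S = Independent G S × ∣ S ∣ ≡ α

  W₂ : Set
  W₂ = ∀ S₁ S₂ → Independent G S₁ → Independent G S₂ → Disjoint G S₁ S₂ →
       Σ (VSet G) λ T₁ → Σ (VSet G) λ T₂ →
         Ω T₁ × Ω T₂ × S₁ ⊆ T₁ × S₂ ⊆ T₂ × Disjoint G T₁ T₂

  N : VSet G → VSet G
  N A = tabulate λ v → any (λ a → lookup A a ∧ adj G v a) (allFin (n G))

  ∂ : VSet G → ℤ
  ∂ A = (+ ∣ N A ─ A ∣) ℤ.- (+ ∣ A ∣)

  open UniqueDec (_≟ᶠ_ {n G}) using (Unique; unique?)

  endpoints : List (V G × V G) → List (V G)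
  endpoints = concatMap (λ e → proj₁ e ∷ proj₂ e ∷ [])

  IsMatching : List (V G × V G) → Set
  IsMatching M = All (λ e → Adj G (proj₁ e) (proj₂ e)) M × Unique (endpoints M)

  isMatching? : ∀ M → Dec (IsMatching M)
  isMatching? M = allL? (λ e → adj? G (proj₁ e) (proj₂ e)) M ×-dec unique? (endpoints M)

  edges : List (V G × V G)
  edges = filter (λ e → (toℕ (proj₁ e) <? toℕ (proj₂ e)) ×-dec adj? G (proj₁ e) (proj₂ e))
            (concatMap (λ u → map (u ,_) (allFin (n G))) (allFin (n G)))

  sublists : ∀ {A : Set} → List A → List (List A)
  sublists []       = [] ∷ []
  sublists (x ∷ xs) = sublists xs ++ map (x ∷_) (sublists xs)

  μ : ℕ
  μ = maxOf (map length (filter isMatching? (sublists edges)))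

  data Reach : V G → V G → Set where
    here : ∀ {u} → Reach u u
    step : ∀ {u v w} → Adj G u v → Reach v w → Reach u w

  Connected : Set
  Connected = 0 < n G × (∀ u v → Reach u v)

  IsK₂ : Set
  IsK₂ = Σ (V G) λ u → Σ (V G) λ v → u ≢ v × Adj G u v × (∀ w → w ≡ u ⊎ w ≡ v)

  -- regularizable: positive integer edge multiplicities giving a regular
  -- multigraph of non-zero degree
  Regularizable : Set
  Regularizable = Σ (V G → V G → ℕ) λ w →
    (∀ u v → w u v ≡ w v u) ×
    (∀ u v → Adj G u v → 1 ≤ w u v) ×
    (∀ u v → ¬ Adj G u v → w u v ≡ 0) ×
    Σ ℕ λ d → 1 ≤ d × (∀ u → sum (map (w u) (allFin (n G))) ≡ d)

module Submission where

-- The basic tool is an exchange argument: if S is independent and T ∈ Ω(G) is disjoint from S, then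
-- (T ∖ N(S)) ∪ S is independent, so |S| ≤ |N(S) ∩ T|. In W₂ every independent S has such a T (apply W₂
-- to S and ∅), and Hall's theorem turns these inequalities into a matching of S into T; this gives (iv)
-- lower bound, (v), (viii), (ix), and with a second disjoint maximum set also (vi). A vertex v with a
-- single neighbour w would, by maximality, make vw a component, so outside K₂ every vertex has two
-- neighbours w₁ ≠ w₂, and W₂ applied to {w₁}, {w₂} gives (i), hence (ii), (iii) and the upper bound in
-- (iv). For (vii), an independent B with |N(B)| ≤ |B| would force V = B ∪ N(B) with N(B) independent,
-- contradicting (ii). Strict expansion then lets Hall's theorem route through any edge xy a permutation σ
-- with i ~ σ(i) for all i, and summing σ + σ⁻¹ over such permutations gives regular edge weights.

open import Defs
open import Data.Nat using (ℕ; _+_; _*_; _∸_; _≤_; _<_)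
open import Data.Integer using () renaming (_≤_ to _≤ℤ_)
open import Data.Fin.Subset using (_∈_; _∉_; _⊆_; ∣_∣; ∁; Nonempty)
open import Data.List.Membership.Propositional using () renaming (_∈_ to _∈ₗ_)
open import Data.Product using (Σ; _×_; _,_)
open import Data.Sum using (_⊎_)
open import Relation.Nullary using (¬_)
open import Relation.Binary.PropositionalEquality using (_≡_)

open import Data.Bool using (true; false; T)
open import Data.Bool.Properties using (T-≡; T-∧)
open import Data.Fin using (Fin; zero; suc; punchOut; toℕ; fromℕ<)
open import Data.Fin.Properties using (any?; _≟_; injective⇒≤; punchOut-injective; toℕ-injective)
open import Data.Fin.Subset using (Subset; _∪_; _∩_; _─_; _-_; ⁅_⁆; ⊥; ⊤; Empty; inside; outside)
open import Data.Fin.Subset.Properties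
open import Data.Integer using (_⊖_)
import Data.Integer as ℤ
import Data.Integer.Properties as ℤ
open import Data.List using (List; []; _∷_; _++_; map; allFin; filter; length; concatMap; cartesianProduct)
open import Data.List.Membership.Propositional using (lose)
open import Data.List.Membership.Propositional.Properties
  using (∈-map⁺; ∈-map⁻; ∈-++⁺ˡ; ∈-++⁺ʳ; ∈-filter⁺; ∈-filter⁻; ∈-allFin; ∈-cartesianProduct⁺)
open import Data.List.Properties using (map-cong)
open import Data.List.Relation.Binary.Disjoint.Propositional using () renaming (Disjoint to ListDisjoint)
open import Data.List.Relation.Unary.All using (All; []; _∷_)
import Data.List.Relation.Unary.All as All
import Data.List.Relation.Unary.All.Properties as All
open import Data.List.Relation.Unary.All.Properties using (All¬⇒¬Any)
open import Data.List.Relation.Unary.AllPairs using (AllPairs; []; _∷_)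
import Data.List.Relation.Unary.AllPairs.Properties as AllPairs
open import Data.List.Relation.Unary.Any using (here; there; satisfied)
open import Data.List.Relation.Unary.Any.Properties using (any⁺; any⁻)
open import Data.List.Relation.Unary.Unique.Propositional using (Unique)
import Data.List.Relation.Unary.Unique.Propositional.Properties as Unique
open import Data.Nat using (zero; suc; z≤n; s≤s; _≤?_; _<?_)
open import Data.Nat.ListAction using (sum)
open import Data.Nat.Properties hiding (_≟_)
open import Data.Nat.Tactic.RingSolver using (solve-∀)
open import Data.Product using (proj₁; proj₂; ∃)
open import Data.Sum using (inj₁; inj₂; [_,_])
open import Data.Vec using ([]; _∷_; here; there)
open import Data.Vec.Properties using ([]=⇒lookup; lookup⇒[]=; lookup∘tabulate)
open import Function using (_∘_; case_of_)
open import Function.Bundles using (Equivalence)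
open import Function.Definitions using (Injective)
open import Relation.Binary.PropositionalEquality using (_≢_; refl; cong; cong₂; subst; module ≡-Reasoning)
import Relation.Binary.PropositionalEquality as ≡
open import Relation.Nullary using (contradiction; yes; no; Dec; does; ¬?)
open import Relation.Nullary.Decidable using (_×-dec_; _⊎-dec_; decidable-stable)

x∈p─q⇒x∉q : ∀ {n} (p q : Subset n) {x} → x ∈ p ─ q → x ∉ q
x∈p─q⇒x∉q (_ ∷ p) (true ∷ q) {zero}  ()
x∈p─q⇒x∉q (_ ∷ p) (_ ∷ q)    {suc x} (there x∈p─q) (there x∈q) = x∈p─q⇒x∉q p q x∈p─q x∈q

∣p∪q∣≤∣p∣+∣q∣ : ∀ {n} (p q : Subset n) → ∣ p ∪ q ∣ ≤ ∣ p ∣ + ∣ q ∣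
∣p∪q∣≤∣p∣+∣q∣ [] [] = z≤n
∣p∪q∣≤∣p∣+∣q∣ (true ∷ p)  (true ∷ q)  = s≤s (≤-trans (∣p∪q∣≤∣p∣+∣q∣ p q) (≤-trans (n≤1+n _) (≤-reflexive (≡.sym (+-suc _ _)))))
∣p∪q∣≤∣p∣+∣q∣ (true ∷ p)  (false ∷ q) = s≤s (∣p∪q∣≤∣p∣+∣q∣ p q)
∣p∪q∣≤∣p∣+∣q∣ (false ∷ p) (true ∷ q)  = ≤-trans (s≤s (∣p∪q∣≤∣p∣+∣q∣ p q)) (≤-reflexive (≡.sym (+-suc _ _)))
∣p∪q∣≤∣p∣+∣q∣ (false ∷ p) (false ∷ q) = ∣p∪q∣≤∣p∣+∣q∣ p q

∣p∪q∣≡∣p∣+∣q∣ : ∀ {n} (p q : Subset n) → (∀ x → x ∈ p → x ∉ q) → ∣ p ∪ q ∣ ≡ ∣ p ∣ + ∣ q ∣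
∣p∪q∣≡∣p∣+∣q∣ [] [] _ = refl
∣p∪q∣≡∣p∣+∣q∣ (true ∷ p)  (true ∷ q)  p∩q=∅ = contradiction here (p∩q=∅ zero here)
∣p∪q∣≡∣p∣+∣q∣ (true ∷ p)  (false ∷ q) p∩q=∅ = cong suc (∣p∪q∣≡∣p∣+∣q∣ p q λ x x∈p x∈q → p∩q=∅ (suc x) (there x∈p) (there x∈q))
∣p∪q∣≡∣p∣+∣q∣ (false ∷ p) (true ∷ q)  p∩q=∅ = ≡.trans (cong suc (∣p∪q∣≡∣p∣+∣q∣ p q λ x x∈p x∈q → p∩q=∅ (suc x) (there x∈p) (there x∈q))) (≡.sym (+-suc _ _))
∣p∪q∣≡∣p∣+∣q∣ (false ∷ p) (false ∷ q) p∩q=∅ = ∣p∪q∣≡∣p∣+∣q∣ p q λ x x∈p x∈q → p∩q=∅ (suc x) (there x∈p) (there x∈q)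

∣p∣≡∣p∩q∣+∣p─q∣ : ∀ {n} (p q : Subset n) → ∣ p ∣ ≡ ∣ p ∩ q ∣ + ∣ p ─ q ∣
∣p∣≡∣p∩q∣+∣p─q∣ [] [] = refl
∣p∣≡∣p∩q∣+∣p─q∣ (true ∷ p)  (true ∷ q)  = cong suc (∣p∣≡∣p∩q∣+∣p─q∣ p q)
∣p∣≡∣p∩q∣+∣p─q∣ (true ∷ p)  (false ∷ q) = ≡.trans (cong suc (∣p∣≡∣p∩q∣+∣p─q∣ p q)) (≡.sym (+-suc _ _))
∣p∣≡∣p∩q∣+∣p─q∣ (false ∷ p) (true ∷ q)  = ∣p∣≡∣p∩q∣+∣p─q∣ p q
∣p∣≡∣p∩q∣+∣p─q∣ (false ∷ p) (false ∷ q) = ∣p∣≡∣p∩q∣+∣p─q∣ p q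

Empty⇒∣p∣≡0 : ∀ {n} {p : Subset n} → Empty p → ∣ p ∣ ≡ 0
Empty⇒∣p∣≡0 {n} empty = ≡.trans (cong ∣_∣ (Empty-unique empty)) (∣⊥∣≡0 n)

∣p∣>0⇒Nonempty : ∀ {n} (p : Subset n) → 0 < ∣ p ∣ → Nonempty p
∣p∣>0⇒Nonempty p ∣p∣>0 with nonempty? p
... | yes nonempty = nonempty
... | no  empty    = contradiction (Empty⇒∣p∣≡0 empty) (>⇒≢ ∣p∣>0)

x∉p⇒∣p∪⁅x⁆∣≡1+∣p∣ : ∀ {n} (p : Subset n) {x} → x ∉ p → ∣ p ∪ ⁅ x ⁆ ∣ ≡ suc ∣ p ∣
x∉p⇒∣p∪⁅x⁆∣≡1+∣p∣ p {x} x∉p = begin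
  ∣ p ∪ ⁅ x ⁆ ∣     ≡⟨ ∣p∪q∣≡∣p∣+∣q∣ p ⁅ x ⁆ (λ y y∈p y∈⁅x⁆ → x∉p (subst (_∈ p) (x∈⁅y⁆⇒x≡y x y∈⁅x⁆) y∈p)) ⟩
  ∣ p ∣ + ∣ ⁅ x ⁆ ∣ ≡⟨ cong (∣ p ∣ +_) (∣⁅x⁆∣≡1 x) ⟩
  ∣ p ∣ + 1         ≡⟨ +-comm ∣ p ∣ 1 ⟩
  suc ∣ p ∣         ∎
  where open ≡-Reasoning

x∈p⇒∣p∣≡1+∣p-x∣ : ∀ {n} (p : Subset n) {x} → x ∈ p → ∣ p ∣ ≡ suc ∣ p - x ∣
x∈p⇒∣p∣≡1+∣p-x∣ p {x} x∈p = ≡.trans (∣p∣≡∣p∩q∣+∣p─q∣ p ⁅ x ⁆) (cong (_+ ∣ p - x ∣) ∣p∩⁅x⁆∣≡1)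
  where
  ∣p∩⁅x⁆∣≡1 : ∣ p ∩ ⁅ x ⁆ ∣ ≡ 1
  ∣p∩⁅x⁆∣≡1 = ≤-antisym
    (≤-trans (∣p∩q∣≤∣q∣ p ⁅ x ⁆) (≤-reflexive (∣⁅x⁆∣≡1 x)))
    (≤-trans (≤-reflexive (≡.sym (∣⁅x⁆∣≡1 x)))
      (p⊆q⇒∣p∣≤∣q∣ λ y∈⁅x⁆ → x∈p∩q⁺ (subst (_∈ p) (≡.sym (x∈⁅y⁆⇒x≡y x y∈⁅x⁆)) x∈p , y∈⁅x⁆)))

p⊆q∪⁅x⁆⇒∣p∣≤1+∣q∣ : ∀ {n} {p q : Subset n} {x} → p ⊆ q ∪ ⁅ x ⁆ → ∣ p ∣ ≤ suc ∣ q ∣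
p⊆q∪⁅x⁆⇒∣p∣≤1+∣q∣ {p = p} {q} {x} p⊆ = begin
  ∣ p ∣             ≤⟨ p⊆q⇒∣p∣≤∣q∣ p⊆ ⟩
  ∣ q ∪ ⁅ x ⁆ ∣     ≤⟨ ∣p∪q∣≤∣p∣+∣q∣ q ⁅ x ⁆ ⟩
  ∣ q ∣ + ∣ ⁅ x ⁆ ∣ ≡⟨ cong (∣ q ∣ +_) (∣⁅x⁆∣≡1 x) ⟩
  ∣ q ∣ + 1         ≡⟨ +-comm ∣ q ∣ 1 ⟩
  suc ∣ q ∣         ∎
  where open ≤-Reasoning

x∉p⇒∣p∣<n : ∀ {n} (p : Subset n) {x} → x ∉ p → ∣ p ∣ < n
x∉p⇒∣p∣<n p x∉p = ≤∧≢⇒< (∣p∣≤n p) λ ∣p∣≡n → x∉p (subst (_ ∈_) (≡.sym (∣p∣≡n⇒p≡⊤ ∣p∣≡n)) ∈⊤)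

∣p─q∣≡∣p∣ : ∀ {n} (p q : Subset n) → (∀ x → x ∈ q → x ∉ p) → ∣ p ─ q ∣ ≡ ∣ p ∣
∣p─q∣≡∣p∣ p q q∩p=∅ = ≤-antisym (∣p─q∣≤∣p∣ p q) (p⊆q⇒∣p∣≤∣q∣ λ x∈p → x∈p∧x∉q⇒x∈p─q x∈p λ x∈q → q∩p=∅ _ x∈q x∈p)

injective⇒surjective : ∀ {n} {f : Fin n → Fin n} → Injective _≡_ _≡_ f → ∀ y → ∃ λ x → f x ≡ y
injective⇒surjective {zero}  _       ()
injective⇒surjective {suc n} {f} f-inj y with any? (λ x → f x ≟ y)
... | yes hit = hit
... | no  miss = contradiction (injective⇒≤ f-punchOut-injective) 1+n≰n
  where
  f-punchOut : Fin (suc n) → Fin n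
  f-punchOut x = punchOut {i = y} {j = f x} λ y≡fx → miss (x , ≡.sym y≡fx)
  f-punchOut-injective : Injective _≡_ _≡_ f-punchOut
  f-punchOut-injective {x} {x′} eq = f-inj (punchOut-injective (λ e → miss (x , ≡.sym e)) (λ e → miss (x′ , ≡.sym e)) eq)

m+d≤o⇒m-n≤o-[n+d] : ∀ {m n o} d → m + d ≤ o → ℤ.+ m ℤ.- ℤ.+ n ℤ.≤ ℤ.+ o ℤ.- ℤ.+ (n + d)
m+d≤o⇒m-n≤o-[n+d] {m} {n} {o} d m+d≤o = begin
  ℤ.+ m ℤ.- ℤ.+ n         ≡⟨ ℤ.m-n≡m⊖n m n ⟩
  m ⊖ n               ≡⟨ ℤ.+-cancelˡ-⊖ d m n ⟨
  (d + m) ⊖ (d + n)   ≡⟨ cong₂ _⊖_ (+-comm d m) (+-comm d n) ⟩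
  (m + d) ⊖ (n + d)   ≤⟨ ℤ.⊖-monoˡ-≤ (n + d) m+d≤o ⟩
  o ⊖ (n + d)         ≡⟨ ℤ.m-n≡m⊖n o (n + d) ⟨
  ℤ.+ o ℤ.- ℤ.+ (n + d)   ∎
  where open ℤ.≤-Reasoning

private
  variable
    A B : Set

𝟙[_] : ∀ {P : Set} → Dec P → ℕ
𝟙[ yes _ ] = 1
𝟙[ no  _ ] = 0


sum-map-+ : ∀ (f g : A → ℕ) xs → sum (map (λ x → f x + g x) xs) ≡ sum (map f xs) + sum (map g xs)
sum-map-+ f g []       = refl
sum-map-+ f g (x ∷ xs) = ≡.trans (cong (f x + g x +_) (sum-map-+ f g xs)) (+-+-comm-middle (f x) (g x) _ _)
  where
  +-+-comm-middle : ∀ a b c d → a + b + (c + d) ≡ a + c + (b + d)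
  +-+-comm-middle = solve-∀

sum-map-0 : ∀ (xs : List A) → sum (map (λ _ → 0) xs) ≡ 0
sum-map-0 []       = refl
sum-map-0 (_ ∷ xs) = sum-map-0 xs

sum-map-comm : ∀ (f : A → B → ℕ) xs ys →
  sum (map (λ x → sum (map (f x) ys)) xs) ≡ sum (map (λ y → sum (map (λ x → f x y) xs)) ys)
sum-map-comm f []       ys = ≡.sym (sum-map-0 ys)
sum-map-comm f (x ∷ xs) ys = ≡.trans (cong (sum (map (f x) ys) +_) (sum-map-comm f xs ys))
                                     (≡.sym (sum-map-+ (f x) (λ y → sum (map (λ x → f x y) xs)) ys))

∈⇒≤sum-map : ∀ (f : A → ℕ) {x xs} → x ∈ₗ xs → f x ≤ sum (map f xs)
∈⇒≤sum-map f {xs = y ∷ ys} (here refl) = m≤m+n (f y) _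
∈⇒≤sum-map f {xs = y ∷ ys} (there x∈) = ≤-trans (∈⇒≤sum-map f x∈) (m≤n+m _ (f y))

AllPairs-with : ∀ {R R′ : A → A → Set} {Q : A → Set} {xs} → AllPairs R xs → All Q xs →
                (∀ {x y} → Q x → Q y → R x y → R′ x y) → AllPairs R′ xs
AllPairs-with []         []         _          = []
AllPairs-with (Rx ∷ Rxs) (Qx ∷ Qxs) strengthen =
  All.zipWith (λ (Rxy , Qy) → strengthen Qx Qy Rxy) (Rx , Qxs) ∷ AllPairs-with Rxs Qxs strengthen

sum-𝟙-none : ∀ {Q : A → Set} (Q? : ∀ x → Dec (Q x)) xs → All (λ x → ¬ Q x) xs → sum (map (λ x → 𝟙[ Q? x ]) xs) ≡ 0
sum-𝟙-none Q? []       []           = refl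
sum-𝟙-none Q? (x ∷ xs) (¬Qx ∷ ¬Qxs) with Q? x
... | yes Qx = contradiction Qx ¬Qx
... | no  _  = sum-𝟙-none Q? xs ¬Qxs

sum-𝟙-unique : ∀ {Q : A → Set} (Q? : ∀ x → Dec (Q x)) {x₀} xs → Unique xs → x₀ ∈ₗ xs → Q x₀ → (∀ {x} → Q x → x ≡ x₀) →
               sum (map (λ x → 𝟙[ Q? x ]) xs) ≡ 1
sum-𝟙-unique Q? (x ∷ xs) (x∉xs ∷ xs!) x₀∈ Qx₀ only-x₀ with Q? x | x₀∈
... | yes Qx | _ = cong suc (sum-𝟙-none Q? xs (All.map (λ x≢y Qy → x≢y (≡.trans (only-x₀ Qx) (≡.sym (only-x₀ Qy)))) x∉xs))
... | no ¬Qx | here refl = contradiction Qx₀ ¬Qx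
... | no ¬Qx | there x₀∈xs = sum-𝟙-unique Q? xs xs! x₀∈xs Qx₀ only-x₀

≤maxOf : ∀ {x xs} → x ∈ₗ xs → x ≤ maxOf xs
≤maxOf {xs = y ∷ ys} (here refl) = m≤m⊔n y (maxOf ys)
≤maxOf {xs = y ∷ ys} (there x∈) = ≤-trans (≤maxOf x∈) (m≤n⊔m y (maxOf ys))

maxOf≤ : ∀ {b} xs → (∀ {x} → x ∈ₗ xs → x ≤ b) → maxOf xs ≤ b
maxOf≤ []       _     = z≤n
maxOf≤ (y ∷ ys) all≤b = ⊔-lub (all≤b (here refl)) (maxOf≤ ys (all≤b ∘ there))

∈allSubsets : ∀ k (S : Subset k) → S ∈ₗ allSubsets k
∈allSubsets zero    []          = here refl
∈allSubsets (suc k) (false ∷ S) = ∈-++⁺ˡ (∈-map⁺ (outside ∷_) (∈allSubsets k S))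
∈allSubsets (suc k) (true ∷ S)  = ∈-++⁺ʳ (map (outside ∷_) (allSubsets k)) (∈-map⁺ (inside ∷_) (∈allSubsets k S))

module _ (G : Graph) where

  Adj-sym : ∀ {u v} → Adj G u v → Adj G v u
  Adj-sym {u} {v} uv = ≡.trans (≡.sym (Graph.sym G u v)) uv

  Adj-irrefl : ∀ {u} → ¬ Adj G u u
  Adj-irrefl {u} uu with ≡.trans (≡.sym (Graph.irrefl G u)) uu
  ... | ()

  Adj⇒≢ : ∀ {u v} → Adj G u v → u ≢ v
  Adj⇒≢ uv refl = Adj-irrefl uv

  ∈N⁻ : ∀ A {v} → v ∈ N G A → ∃ λ a → a ∈ A × Adj G v a
  ∈N⁻ A {v} v∈NA = a , lookup⇒[]= a A (T⇒≡ a∈A) , T⇒≡ va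
    where
    T⇒≡ : ∀ {b} → T b → b ≡ true
    T⇒≡ = Equivalence.to T-≡
    any-a = any⁻ _ (allFin (n G)) (Equivalence.from T-≡ (≡.trans (≡.sym (lookup∘tabulate _ v)) ([]=⇒lookup v∈NA)))
    a = proj₁ (satisfied any-a)
    a∈A = proj₁ (Equivalence.to T-∧ (proj₂ (satisfied any-a)))
    va = proj₂ (Equivalence.to T-∧ (proj₂ (satisfied any-a)))

  ∈N⁺ : ∀ A {v a} → a ∈ A → Adj G v a → v ∈ N G A
  ∈N⁺ A {v} {a} a∈A va = lookup⇒[]= v (N G A) (≡.trans (lookup∘tabulate _ v) (Equivalence.to T-≡ any-true))
    where
    any-true = any⁺ _ (lose (∈-allFin a) (Equivalence.from T-∧ (Equivalence.from T-≡ ([]=⇒lookup a∈A) , Equivalence.from T-≡ va)))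

  N-mono : ∀ {A B} → A ⊆ B → N G A ⊆ N G B
  N-mono {A} {B} A⊆B v∈NA with ∈N⁻ A v∈NA
  ... | a , a∈A , va = ∈N⁺ B (A⊆B a∈A) va

  Independent-⊆ : ∀ {P Q} → P ⊆ Q → Independent G Q → Independent G P
  Independent-⊆ P⊆Q indQ u v u∈P v∈P = indQ u v (P⊆Q u∈P) (P⊆Q v∈P)

  Independent-∪ : ∀ P Q → Independent G P → Independent G Q → (∀ u v → u ∈ P → v ∈ Q → ¬ Adj G u v) →
                  Independent G (P ∪ Q)
  Independent-∪ P Q indP indQ P≁Q u v u∈ v∈ with x∈p∪q⁻ P Q u∈ | x∈p∪q⁻ P Q v∈
  ... | inj₁ u∈P | inj₁ v∈P = indP u v u∈P v∈P
  ... | inj₁ u∈P | inj₂ v∈Q = P≁Q u v u∈P v∈Q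
  ... | inj₂ u∈Q | inj₁ v∈P = P≁Q v u v∈P u∈Q ∘ Adj-sym
  ... | inj₂ u∈Q | inj₂ v∈Q = indQ u v u∈Q v∈Q

  Independent-⊥ : Independent G ⊥
  Independent-⊥ u v u∈⊥ = contradiction u∈⊥ ∉⊥

  Independent-⁅⁆ : ∀ x → Independent G ⁅ x ⁆
  Independent-⁅⁆ x u v u∈ v∈ uv = Adj⇒≢ uv (≡.trans (x∈⁅y⁆⇒x≡y x u∈) (≡.sym (x∈⁅y⁆⇒x≡y x v∈)))

  Independent⇒Disjoint-N : ∀ {A} → Independent G A → Disjoint G A (N G A)
  Independent⇒Disjoint-N {A} indA v v∈A v∈NA with ∈N⁻ A v∈NA
  ... | a , a∈A , va = indA v a v∈A a∈A va

  ∣S∣≤α : ∀ {S} → Independent G S → ∣ S ∣ ≤ α G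
  ∣S∣≤α {S} indS = ≤maxOf (∈-map⁺ ∣_∣ (∈-filter⁺ (independent? G) (∈allSubsets _ S) indS))

  ∣S∣≤αOn : ∀ X {S} → Independent G S → S ⊆ X → ∣ S ∣ ≤ αOn G X
  ∣S∣≤αOn X {S} indS S⊆X = ≤maxOf (∈-map⁺ ∣_∣ (∈-filter⁺ (λ S → independent? G S ×-dec (S ⊆? X)) (∈allSubsets _ S) (indS , S⊆X)))

  αOn≤α : ∀ X → αOn G X ≤ α G
  αOn≤α X = maxOf≤ _ λ x∈ → let S , S∈ , x≡∣S∣ = ∈-map⁻ ∣_∣ x∈ in
    ≤-trans (≤-reflexive x≡∣S∣) (∣S∣≤α (proj₁ (proj₂ (∈-filter⁻ (λ S → independent? G S ×-dec (S ⊆? X)) {xs = allSubsets (n G)} S∈))))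

  Reach-closed : (C : V G → Set) → (∀ {a b} → C a → Adj G a b → C b) → ∀ {a b} → Reach G a b → C a → C b
  Reach-closed C closed here       Ca = Ca
  Reach-closed C closed (step ab r) Ca = Reach-closed C closed r (closed Ca ab)

  -- Exchange argument: (T ─ N(S)) ∪ S is independent, so it is no larger than the maximum set T.
  ∣S∣≤∣NS∩T∣ : ∀ {S T} → Independent G S → Ω G T → Disjoint G S T → ∣ S ∣ ≤ ∣ N G S ∩ T ∣
  ∣S∣≤∣NS∩T∣ {S} {T} indS (indT , ∣T∣≡α) S∩T=∅ = +-cancelˡ-≤ (∣ T ─ N G S ∣) (∣ S ∣) (∣ N G S ∩ T ∣) (begin
    ∣ T ─ N G S ∣ + ∣ S ∣           ≡⟨ ∣p∪q∣≡∣p∣+∣q∣ (T ─ N G S) S (λ x x∈T─NS x∈S → S∩T=∅ x x∈S (p─q⊆p T (N G S) x∈T─NS)) ⟨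
    ∣ (T ─ N G S) ∪ S ∣             ≤⟨ ∣S∣≤α (Independent-∪ (T ─ N G S) S (Independent-⊆ (p─q⊆p T (N G S)) indT) indS T─NS≁S) ⟩
    α G                             ≡⟨ ∣T∣≡α ⟨
    ∣ T ∣                           ≡⟨ ∣p∣≡∣p∩q∣+∣p─q∣ T (N G S) ⟩
    ∣ T ∩ N G S ∣ + ∣ T ─ N G S ∣   ≡⟨ +-comm (∣ T ∩ N G S ∣) (∣ T ─ N G S ∣) ⟩
    ∣ T ─ N G S ∣ + ∣ T ∩ N G S ∣   ≡⟨ cong (∣ T ─ N G S ∣ +_) (cong ∣_∣ (∩-comm T (N G S))) ⟩
    ∣ T ─ N G S ∣ + ∣ N G S ∩ T ∣   ∎)
    where
    open ≤-Reasoning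
    T─NS≁S : ∀ u v → u ∈ T ─ N G S → v ∈ S → ¬ Adj G u v
    T─NS≁S u v u∈ v∈S uv = x∈p─q⇒x∉q T (N G S) u∈ (∈N⁺ S v∈S uv)

  disjoint-Ω-pair⇒2α+1≤n : ∀ {S₁ S₂ v} → Ω G S₁ → Ω G S₂ → Disjoint G S₁ S₂ → v ∉ S₁ → v ∉ S₂ → 2 * α G + 1 ≤ n G
  disjoint-Ω-pair⇒2α+1≤n {S₁} {S₂} (_ , ∣S₁∣≡α) (_ , ∣S₂∣≡α) S₁∩S₂=∅ v∉S₁ v∉S₂ = begin
    2 * α G + 1           ≡⟨ +-comm (2 * α G) 1 ⟩
    suc (α G + (α G + 0)) ≡⟨ cong (λ k → suc (α G + k)) (+-identityʳ (α G)) ⟩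
    suc (α G + α G)       ≡⟨ cong suc (cong₂ _+_ ∣S₁∣≡α ∣S₂∣≡α) ⟨
    suc (∣ S₁ ∣ + ∣ S₂ ∣) ≡⟨ cong suc (∣p∪q∣≡∣p∣+∣q∣ S₁ S₂ S₁∩S₂=∅) ⟨
    suc ∣ S₁ ∪ S₂ ∣       ≤⟨ x∉p⇒∣p∣<n (S₁ ∪ S₂) ([ v∉S₁ , v∉S₂ ] ∘ x∈p∪q⁻ S₁ S₂) ⟩
    n G                   ∎
    where open ≤-Reasoning

  ∣S∣<∣NS∣-via-Ω : ∀ {S T y} → Independent G S → Ω G T → Disjoint G S T → y ∈ N G S → y ∉ T → ∣ S ∣ < ∣ N G S ∣
  ∣S∣<∣NS∣-via-Ω {S} {T} {y} indS ΩT S∩T=∅ y∈NS y∉T = begin-strict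
    ∣ S ∣             ≤⟨ ∣S∣≤∣NS∩T∣ indS ΩT S∩T=∅ ⟩
    ∣ N G S ∩ T ∣     ≤⟨ p⊆q⇒∣p∣≤∣q∣ NS∩T⊆NS-y ⟩
    ∣ N G S - y ∣     <⟨ n<1+n _ ⟩
    suc ∣ N G S - y ∣ ≡⟨ x∈p⇒∣p∣≡1+∣p-x∣ (N G S) y∈NS ⟨
    ∣ N G S ∣         ∎
    where
    open ≤-Reasoning
    NS∩T⊆NS-y : N G S ∩ T ⊆ N G S - y
    NS∩T⊆NS-y x∈ = let x∈NS , x∈T = x∈p∩q⁻ (N G S) T x∈ in
      x∈p∧x∉q⇒x∈p─q x∈NS λ x∈⁅y⁆ → y∉T (subst (_∈ T) (x∈⁅y⁆⇒x≡y y x∈⁅y⁆) x∈T)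

  independent-cover⇒n≤2α : ∀ {B} → Independent G B → Independent G (N G B) → (∀ v → v ∈ B ⊎ v ∈ N G B) → n G ≤ α G + α G
  independent-cover⇒n≤2α {B} indB indNB covered = begin
    n G                 ≡⟨ ∣⊤∣≡n (n G) ⟨
    ∣ ⊤ {n G} ∣         ≤⟨ p⊆q⇒∣p∣≤∣q∣ {p = ⊤} (λ {v} _ → x∈p∪q⁺ (covered v)) ⟩
    ∣ B ∪ N G B ∣       ≤⟨ ∣p∪q∣≤∣p∣+∣q∣ B (N G B) ⟩
    ∣ B ∣ + ∣ N G B ∣   ≤⟨ +-mono-≤ (∣S∣≤α indB) (∣S∣≤α indNB) ⟩
    α G + α G           ∎
    where open ≤-Reasoning

  -- Hall's theorem

  HallCondition : VSet G → VSet G → Set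
  HallCondition X Y = ∀ S → S ⊆ X → ∣ S ∣ ≤ ∣ N G S ∩ Y ∣

  record Saturating (X Y : VSet G) : Set where
    field
      match           : V G → V G
      match-adj       : ∀ {x} → x ∈ X → Adj G x (match x)
      match-∈         : ∀ {x} → x ∈ X → match x ∈ Y
      match-injective : ∀ {x x′} → x ∈ X → x′ ∈ X → match x ≡ match x′ → x ≡ x′

  open Saturating

  Saturating-empty : ∀ {X Y} → Empty X → Saturating X Y
  Saturating-empty empty = record
    { match = λ x → x ; match-adj = λ x∈X → contradiction (_ , x∈X) empty
    ; match-∈ = λ x∈X → contradiction (_ , x∈X) empty ; match-injective = λ x∈X _ _ → contradiction (_ , x∈X) empty }

  Saturating-⁅⁆ : ∀ {x y} → Adj G x y → Saturating ⁅ x ⁆ ⁅ y ⁆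
  Saturating-⁅⁆ {x} {y} xy = record
    { match = λ _ → y
    ; match-adj = λ z∈⁅x⁆ → subst (λ z → Adj G z y) (≡.sym (x∈⁅y⁆⇒x≡y x z∈⁅x⁆)) xy
    ; match-∈ = λ _ → x∈⁅x⁆ y
    ; match-injective = λ z∈⁅x⁆ z′∈⁅x⁆ _ → ≡.trans (x∈⁅y⁆⇒x≡y x z∈⁅x⁆) (≡.sym (x∈⁅y⁆⇒x≡y x z′∈⁅x⁆)) }

  Saturating-weaken : ∀ {X X′ Y Y′} → X′ ⊆ X → Y ⊆ Y′ → Saturating X Y → Saturating X′ Y′
  Saturating-weaken X′⊆X Y⊆Y′ sat = record
    { match = match sat
    ; match-adj = match-adj sat ∘ X′⊆X
    ; match-∈ = Y⊆Y′ ∘ match-∈ sat ∘ X′⊆X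
    ; match-injective = λ x∈ x′∈ → match-injective sat (X′⊆X x∈) (X′⊆X x′∈) }

  private
    glue : VSet G → (V G → V G) → (V G → V G) → V G → V G
    glue X₁ f g x with x ∈? X₁
    ... | yes _ = f x
    ... | no  _ = g x

    glue-∈ : ∀ {X₁ f g x} → x ∈ X₁ → glue X₁ f g x ≡ f x
    glue-∈ {X₁} {x = x} x∈X₁ with x ∈? X₁
    ... | yes _    = refl
    ... | no  x∉X₁ = contradiction x∈X₁ x∉X₁

  Saturating-∪ : ∀ {X₁ X₂ Y₁ Y₂} → Disjoint G Y₁ Y₂ → Saturating X₁ Y₁ → Saturating X₂ Y₂ →
                 Saturating (X₁ ∪ X₂) (Y₁ ∪ Y₂)
  Saturating-∪ {X₁} {X₂} {Y₁} {Y₂} Y₁∩Y₂=∅ sat₁ sat₂ = record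
    { match = f ; match-adj = proj₁ ∘ f-ok ; match-∈ = proj₂ ∘ f-ok ; match-injective = f-injective }
    where
    f = glue X₁ (match sat₁) (match sat₂)

    in₂ : ∀ {x} → x ∈ X₁ ∪ X₂ → x ∉ X₁ → x ∈ X₂
    in₂ x∈ x∉X₁ = [ (λ x∈X₁ → contradiction x∈X₁ x∉X₁) , (λ x∈X₂ → x∈X₂) ] (x∈p∪q⁻ X₁ X₂ x∈)

    f-ok : ∀ {x} → x ∈ X₁ ∪ X₂ → Adj G x (f x) × f x ∈ Y₁ ∪ Y₂
    f-ok {x} x∈ with x ∈? X₁
    ... | yes x∈X₁ = match-adj sat₁ x∈X₁ , x∈p∪q⁺ (inj₁ (match-∈ sat₁ x∈X₁))
    ... | no  x∉X₁ = match-adj sat₂ (in₂ x∈ x∉X₁) , x∈p∪q⁺ (inj₂ (match-∈ sat₂ (in₂ x∈ x∉X₁)))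

    crossing : ∀ {x x′} → x ∈ X₁ → x′ ∈ X₂ → match sat₁ x ≢ match sat₂ x′
    crossing x∈X₁ x′∈X₂ eq = Y₁∩Y₂=∅ _ (match-∈ sat₁ x∈X₁) (subst (_∈ Y₂) (≡.sym eq) (match-∈ sat₂ x′∈X₂))

    f-injective : ∀ {x x′} → x ∈ X₁ ∪ X₂ → x′ ∈ X₁ ∪ X₂ → f x ≡ f x′ → x ≡ x′
    f-injective {x} {x′} x∈ x′∈ eq with x ∈? X₁ | x′ ∈? X₁
    ... | yes x∈X₁ | yes x′∈X₁ = match-injective sat₁ x∈X₁ x′∈X₁ eq
    ... | no  x∉X₁ | no  x′∉X₁ = match-injective sat₂ (in₂ x∈ x∉X₁) (in₂ x′∈ x′∉X₁) eq
    ... | yes x∈X₁ | no  x′∉X₁ = contradiction eq (crossing x∈X₁ (in₂ x′∈ x′∉X₁))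
    ... | no  x∉X₁ | yes x′∈X₁ = contradiction (≡.sym eq) (crossing x′∈X₁ (in₂ x∈ x∉X₁))

  HallCondition-⊆ : ∀ {X Y S} → HallCondition X Y → S ⊆ X → HallCondition S (N G S ∩ Y)
  HallCondition-⊆ {X} {Y} {S} hallXY S⊆X S′ S′⊆S = ≤-trans (hallXY S′ (S⊆X ∘ S′⊆S)) (p⊆q⇒∣p∣≤∣q∣ shrink)
    where
    shrink : N G S′ ∩ Y ⊆ N G S′ ∩ (N G S ∩ Y)
    shrink z∈ = let z∈NS′ , z∈Y = x∈p∩q⁻ _ _ z∈ in x∈p∩q⁺ (z∈NS′ , x∈p∩q⁺ (N-mono S′⊆S z∈NS′ , z∈Y))

  Critical : VSet G → VSet G → VSet G → Set
  Critical X Y S = Nonempty S × S ⊆ X × ∣ S ∣ < ∣ X ∣ × ∣ N G S ∩ Y ∣ ≤ ∣ S ∣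

  critical? : ∀ X Y S → Dec (Critical X Y S)
  critical? X Y S = nonempty? S ×-dec S ⊆? X ×-dec ∣ S ∣ <? ∣ X ∣ ×-dec ∣ N G S ∩ Y ∣ ≤? ∣ S ∣

  -- Removing a critical S, whose neighbours in Y are exhausted by S itself, keeps Hall's condition.
  HallCondition-─critical : ∀ {X Y S} → HallCondition X Y → Critical X Y S → HallCondition (X ─ S) (Y ─ N G S)
  HallCondition-─critical {X} {Y} {S} hallXY (_ , S⊆X , _ , ∣NS∩Y∣≤∣S∣) S′ S′⊆X─S = +-cancelʳ-≤ (∣ S ∣) (∣ S′ ∣) (∣ N G S′ ∩ (Y ─ N G S) ∣) (begin
    ∣ S′ ∣ + ∣ S ∣                          ≡⟨ ≡.sym (∣p∪q∣≡∣p∣+∣q∣ S′ S λ x x∈S′ → x∈p─q⇒x∉q X S (S′⊆X─S x∈S′)) ⟩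
    ∣ S′ ∪ S ∣                              ≤⟨ hallXY (S′ ∪ S) S′∪S⊆X ⟩
    ∣ N G (S′ ∪ S) ∩ Y ∣                    ≤⟨ p⊆q⇒∣p∣≤∣q∣ split ⟩
    ∣ (N G S′ ∩ (Y ─ N G S)) ∪ (N G S ∩ Y) ∣ ≤⟨ ∣p∪q∣≤∣p∣+∣q∣ (N G S′ ∩ (Y ─ N G S)) (N G S ∩ Y) ⟩
    ∣ N G S′ ∩ (Y ─ N G S) ∣ + ∣ N G S ∩ Y ∣ ≤⟨ +-monoʳ-≤ _ ∣NS∩Y∣≤∣S∣ ⟩
    ∣ N G S′ ∩ (Y ─ N G S) ∣ + ∣ S ∣         ∎)
    where
    open ≤-Reasoning
    S′∪S⊆X : S′ ∪ S ⊆ X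
    S′∪S⊆X x∈ = [ (λ x∈S′ → p─q⊆p X S (S′⊆X─S x∈S′)) , S⊆X ] (x∈p∪q⁻ S′ S x∈)
    split : N G (S′ ∪ S) ∩ Y ⊆ (N G S′ ∩ (Y ─ N G S)) ∪ (N G S ∩ Y)
    split {z} z∈ with x∈p∩q⁻ _ _ z∈ | z ∈? N G S
    ... | _ , z∈Y | yes z∈NS = x∈p∪q⁺ (inj₂ (x∈p∩q⁺ (z∈NS , z∈Y)))
    ... | z∈N , z∈Y | no z∉NS with ∈N⁻ (S′ ∪ S) z∈N
    ...   | a , a∈ , za = [ (λ a∈S′ → x∈p∪q⁺ (inj₁ (x∈p∩q⁺ (∈N⁺ S′ a∈S′ za , x∈p∧x∉q⇒x∈p─q z∈Y z∉NS))))
                          , (λ a∈S → contradiction (∈N⁺ S a∈S za) z∉NS) ] (x∈p∪q⁻ S′ S a∈)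

  -- Without critical sets every proper nonempty S ⊆ X has a surplus neighbour in Y, so one edge xy may be spent.
  HallCondition-─edge : ∀ {X Y x y} → HallCondition X Y → (∀ S → ¬ Critical X Y S) → x ∈ X →
                    HallCondition (X - x) (Y - y)
  HallCondition-─edge {X} {Y} {x} {y} hallXY noCritical x∈X S S⊆X-x with nonempty? S
  ... | no  empty    = ≤-trans (≤-reflexive (Empty⇒∣p∣≡0 empty)) z≤n
  ... | yes nonempty = ≤-pred (begin-strict
    ∣ S ∣                    <⟨ ≰⇒> (λ ∣NS∩Y∣≤∣S∣ → noCritical S (nonempty , S⊆X , ∣S∣<∣X∣ , ∣NS∩Y∣≤∣S∣)) ⟩
    ∣ N G S ∩ Y ∣            ≤⟨ p⊆q∪⁅x⁆⇒∣p∣≤1+∣q∣ split ⟩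
    suc ∣ N G S ∩ (Y - y) ∣ ∎)
    where
    open ≤-Reasoning
    S⊆X : S ⊆ X
    S⊆X = p─q⊆p X ⁅ x ⁆ ∘ S⊆X-x
    ∣S∣<∣X∣ : ∣ S ∣ < ∣ X ∣
    ∣S∣<∣X∣ = begin-strict
      ∣ S ∣         ≤⟨ p⊆q⇒∣p∣≤∣q∣ S⊆X-x ⟩
      ∣ X - x ∣     <⟨ n<1+n _ ⟩
      suc ∣ X - x ∣ ≡⟨ ≡.sym (x∈p⇒∣p∣≡1+∣p-x∣ X x∈X) ⟩
      ∣ X ∣         ∎
    split : N G S ∩ Y ⊆ (N G S ∩ (Y - y)) ∪ ⁅ y ⁆
    split {z} z∈ with z ≟ y
    ... | yes refl = x∈p∪q⁺ (inj₂ (x∈⁅x⁆ y))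
    ... | no  z≢y  = let z∈NS , z∈Y = x∈p∩q⁻ _ _ z∈ in
                     x∈p∪q⁺ (inj₁ (x∈p∩q⁺ (z∈NS , x∈p∧x∉q⇒x∈p─q z∈Y (z≢y ∘ x∈⁅y⁆⇒x≡y y))))

  private
    SaturatingBelow : ℕ → Set
    SaturatingBelow k = ∀ X Y → ∣ X ∣ ≤ k → HallCondition X Y → Saturating X Y

  hall-split : ∀ {k X Y S} → SaturatingBelow k → ∣ X ∣ ≤ suc k → HallCondition X Y → Critical X Y S → Saturating X Y
  hall-split {k} {X} {Y} {S} ih ∣X∣≤1+k hallXY crit@((s , s∈S) , S⊆X , ∣S∣<∣X∣ , _) =
    Saturating-weaken X⊆S∪X─S NS∩Y∪Y─NS⊆Y (Saturating-∪ disjoint within-S beyond-S)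
    where
    within-S : Saturating S (N G S ∩ Y)
    within-S = ih S (N G S ∩ Y) (≤-pred (≤-trans ∣S∣<∣X∣ ∣X∣≤1+k)) (HallCondition-⊆ hallXY S⊆X)
    beyond-S : Saturating (X ─ S) (Y ─ N G S)
    beyond-S = ih (X ─ S) (Y ─ N G S)
      (≤-pred (≤-trans (p∩q≢∅⇒∣p─q∣<∣p∣ X S (s , x∈p∩q⁺ (S⊆X s∈S , s∈S))) ∣X∣≤1+k))
      (HallCondition-─critical hallXY crit)
    disjoint : Disjoint G (N G S ∩ Y) (Y ─ N G S)
    disjoint z z∈ z∈′ = x∈p─q⇒x∉q Y (N G S) z∈′ (proj₁ (x∈p∩q⁻ (N G S) Y z∈))
    X⊆S∪X─S : X ⊆ S ∪ (X ─ S)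
    X⊆S∪X─S {z} z∈X with z ∈? S
    ... | yes z∈S = x∈p∪q⁺ (inj₁ z∈S)
    ... | no  z∉S = x∈p∪q⁺ (inj₂ (x∈p∧x∉q⇒x∈p─q z∈X z∉S))
    NS∩Y∪Y─NS⊆Y : (N G S ∩ Y) ∪ (Y ─ N G S) ⊆ Y
    NS∩Y∪Y─NS⊆Y z∈ = [ p∩q⊆q (N G S) Y , p─q⊆p Y (N G S) ] (x∈p∪q⁻ _ _ z∈)

  hall-extend : ∀ {k X Y x} → SaturatingBelow k → ∣ X ∣ ≤ suc k → HallCondition X Y → (∀ S → ¬ Critical X Y S) →
                x ∈ X → Saturating X Y
  hall-extend {k} {X} {Y} {x} ih ∣X∣≤1+k hallXY noCritical x∈X =
    Saturating-weaken X⊆x∪X-x y∪Y-y⊆Y (Saturating-∪ disjoint (Saturating-⁅⁆ xy) rest)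
    where
    y∈N⁅x⁆∩Y : Nonempty (N G ⁅ x ⁆ ∩ Y)
    y∈N⁅x⁆∩Y = ∣p∣>0⇒Nonempty _ (≤-trans (≤-reflexive (≡.sym (∣⁅x⁆∣≡1 x)))
                                          (hallXY ⁅ x ⁆ λ z∈⁅x⁆ → subst (_∈ X) (≡.sym (x∈⁅y⁆⇒x≡y x z∈⁅x⁆)) x∈X))
    y = proj₁ y∈N⁅x⁆∩Y
    y∈Y : y ∈ Y
    y∈Y = proj₂ (x∈p∩q⁻ (N G ⁅ x ⁆) Y (proj₂ y∈N⁅x⁆∩Y))
    xy : Adj G x y
    xy with ∈N⁻ ⁅ x ⁆ (proj₁ (x∈p∩q⁻ (N G ⁅ x ⁆) Y (proj₂ y∈N⁅x⁆∩Y)))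
    ... | a , a∈⁅x⁆ , ya = Adj-sym (subst (Adj G y) (x∈⁅y⁆⇒x≡y x a∈⁅x⁆) ya)
    rest : Saturating (X - x) (Y - y)
    rest = ih (X - x) (Y - y) (≤-pred (≤-trans (≤-reflexive (≡.sym (x∈p⇒∣p∣≡1+∣p-x∣ X x∈X))) ∣X∣≤1+k))
              (HallCondition-─edge hallXY noCritical x∈X)
    disjoint : Disjoint G ⁅ y ⁆ (Y - y)
    disjoint z z∈⁅y⁆ z∈Y-y = x∈p─q⇒x∉q Y ⁅ y ⁆ z∈Y-y z∈⁅y⁆
    X⊆x∪X-x : X ⊆ ⁅ x ⁆ ∪ (X - x)
    X⊆x∪X-x {z} z∈X with z ≟ x
    ... | yes refl = x∈p∪q⁺ (inj₁ (x∈⁅x⁆ x))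
    ... | no  z≢x  = x∈p∪q⁺ (inj₂ (x∈p∧x∉q⇒x∈p─q z∈X (z≢x ∘ x∈⁅y⁆⇒x≡y x)))
    y∪Y-y⊆Y : ⁅ y ⁆ ∪ (Y - y) ⊆ Y
    y∪Y-y⊆Y z∈ = [ (λ z∈⁅y⁆ → subst (_∈ Y) (≡.sym (x∈⁅y⁆⇒x≡y y z∈⁅y⁆)) y∈Y) , p─q⊆p Y ⁅ y ⁆ ] (x∈p∪q⁻ _ _ z∈)

  hall : ∀ X Y → HallCondition X Y → Saturating X Y
  hall X Y = saturating-below ∣ X ∣ X Y ≤-refl
    where
    saturating-below : ∀ k → SaturatingBelow k
    saturating-below k X Y ∣X∣≤k hallXY with nonempty? X
    ... | no empty = Saturating-empty empty
    saturating-below zero X Y ∣X∣≤0 hallXY | yes (x , x∈X) =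
      contradiction (≡.trans (≡.sym (x∈p⇒∣p∣≡1+∣p-x∣ X x∈X)) (n≤0⇒n≡0 ∣X∣≤0)) λ ()
    saturating-below (suc k) X Y ∣X∣≤1+k hallXY | yes (x , x∈X) with anySubset? (critical? X Y)
    ... | yes (S , crit) = hall-split (saturating-below k) ∣X∣≤1+k hallXY crit
    ... | no  noCrit     = hall-extend (saturating-below k) ∣X∣≤1+k hallXY (λ S crit → noCrit (S , crit)) x∈X

  HallCondition-Ω : ∀ {X T} → Independent G X → Ω G T → Disjoint G X T → HallCondition X T
  HallCondition-Ω indX ΩT X∩T=∅ S S⊆X = ∣S∣≤∣NS∩T∣ (Independent-⊆ S⊆X indX) ΩT (λ x x∈S → X∩T=∅ x (S⊆X x∈S))

  endpointSet : List (V G × V G) → VSet G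
  endpointSet []            = ⊥
  endpointSet ((a , b) ∷ M) = (⁅ a ⁆ ∪ ⁅ b ⁆) ∪ endpointSet M

  ∈endpointSet⁺ : ∀ {M e} → e ∈ₗ M → proj₁ e ∈ endpointSet M × proj₂ e ∈ endpointSet M
  ∈endpointSet⁺ {(a , b) ∷ M} (here refl) = x∈p∪q⁺ (inj₁ (x∈p∪q⁺ (inj₁ (x∈⁅x⁆ a)))) , x∈p∪q⁺ (inj₁ (x∈p∪q⁺ (inj₂ (x∈⁅x⁆ b))))
  ∈endpointSet⁺ {(a , b) ∷ M} (there e∈M) = let a′∈ , b′∈ = ∈endpointSet⁺ e∈M in x∈p∪q⁺ (inj₂ a′∈) , x∈p∪q⁺ (inj₂ b′∈)

  ∈endpointSet⁻ : ∀ M {x} → x ∈ endpointSet M → x ∈ₗ endpoints G M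
  ∈endpointSet⁻ []            x∈ = contradiction x∈ ∉⊥
  ∈endpointSet⁻ ((a , b) ∷ M) x∈ with x∈p∪q⁻ _ _ x∈
  ... | inj₂ x∈M = there (there (∈endpointSet⁻ M x∈M))
  ... | inj₁ x∈ab = [ (λ x∈⁅a⁆ → here (x∈⁅y⁆⇒x≡y a x∈⁅a⁆)) , (λ x∈⁅b⁆ → there (here (x∈⁅y⁆⇒x≡y b x∈⁅b⁆))) ] (x∈p∪q⁻ _ _ x∈ab)

  ∣endpointSet∣ : ∀ M → Unique (endpoints G M) → ∣ endpointSet M ∣ ≡ length M + length M
  ∣endpointSet∣ []            _                              = ∣⊥∣≡0 (n G)
  ∣endpointSet∣ ((a , b) ∷ M) ((a≢b ∷ a∉M) ∷ b∉M ∷ M-unique) = begin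
    ∣ (⁅ a ⁆ ∪ ⁅ b ⁆) ∪ endpointSet M ∣       ≡⟨ ∣p∪q∣≡∣p∣+∣q∣ _ _ ab∩M=∅ ⟩
    ∣ ⁅ a ⁆ ∪ ⁅ b ⁆ ∣ + ∣ endpointSet M ∣     ≡⟨ cong₂ _+_ (∣p∪q∣≡∣p∣+∣q∣ _ _ a∩b=∅) (∣endpointSet∣ M M-unique) ⟩
    ∣ ⁅ a ⁆ ∣ + ∣ ⁅ b ⁆ ∣ + (length M + length M) ≡⟨ cong₂ (λ i j → i + j + (length M + length M)) (∣⁅x⁆∣≡1 a) (∣⁅x⁆∣≡1 b) ⟩
    2 + (length M + length M)                 ≡⟨ cong suc (+-suc (length M) (length M)) ⟨
    suc (length M) + suc (length M)           ∎
    where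
    open ≡-Reasoning
    a∩b=∅ : Disjoint G ⁅ a ⁆ ⁅ b ⁆
    a∩b=∅ x x∈⁅a⁆ x∈⁅b⁆ = a≢b (≡.trans (≡.sym (x∈⁅y⁆⇒x≡y a x∈⁅a⁆)) (x∈⁅y⁆⇒x≡y b x∈⁅b⁆))
    ∉M : ∀ {y} → All (y ≢_) (endpoints G M) → y ∉ endpointSet M
    ∉M y∉ y∈ = All¬⇒¬Any y∉ (∈endpointSet⁻ M y∈)
    ab∩M=∅ : Disjoint G (⁅ a ⁆ ∪ ⁅ b ⁆) (endpointSet M)
    ab∩M=∅ x x∈ab = [ (λ x∈⁅a⁆ → subst (_∉ endpointSet M) (≡.sym (x∈⁅y⁆⇒x≡y a x∈⁅a⁆)) (∉M a∉M))
                    , (λ x∈⁅b⁆ → subst (_∉ endpointSet M) (≡.sym (x∈⁅y⁆⇒x≡y b x∈⁅b⁆)) (∉M b∉M)) ] (x∈p∪q⁻ _ _ x∈ab)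

  private
    ∣S∩endpointSet-∷∣ : ∀ S a b M → ∣ S ∩ endpointSet ((a , b) ∷ M) ∣ ≤ ∣ S ∩ (⁅ a ⁆ ∪ ⁅ b ⁆) ∣ + ∣ S ∩ endpointSet M ∣
    ∣S∩endpointSet-∷∣ S a b M = ≤-trans (≤-reflexive (cong ∣_∣ (∩-distribˡ-∪ S (⁅ a ⁆ ∪ ⁅ b ⁆) (endpointSet M))))
                                         (∣p∪q∣≤∣p∣+∣q∣ (S ∩ (⁅ a ⁆ ∪ ⁅ b ⁆)) (S ∩ endpointSet M))

    ∣S∩edge∣≤1 : ∀ {S a b} → Independent G S → Adj G a b → ∣ S ∩ (⁅ a ⁆ ∪ ⁅ b ⁆) ∣ ≤ 1
    ∣S∩edge∣≤1 {S} {a} {b} indS ab with a ∈? S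
    ... | yes a∈S = ≤-trans (p⊆q⇒∣p∣≤∣q∣ only-a) (≤-reflexive (∣⁅x⁆∣≡1 a))
      where
      only-a : S ∩ (⁅ a ⁆ ∪ ⁅ b ⁆) ⊆ ⁅ a ⁆
      only-a z∈ with x∈p∩q⁻ S _ z∈
      ... | z∈S , z∈ab = [ (λ z∈⁅a⁆ → z∈⁅a⁆)
                         , (λ z∈⁅b⁆ → contradiction ab (indS a _ a∈S (subst (_∈ S) (x∈⁅y⁆⇒x≡y b z∈⁅b⁆) z∈S))) ] (x∈p∪q⁻ _ _ z∈ab)
    ... | no  a∉S = ≤-trans (p⊆q⇒∣p∣≤∣q∣ only-b) (≤-reflexive (∣⁅x⁆∣≡1 b))
      where
      only-b : S ∩ (⁅ a ⁆ ∪ ⁅ b ⁆) ⊆ ⁅ b ⁆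
      only-b z∈ with x∈p∩q⁻ S _ z∈
      ... | z∈S , z∈ab = [ (λ z∈⁅a⁆ → contradiction (subst (_∈ S) (x∈⁅y⁆⇒x≡y a z∈⁅a⁆) z∈S) a∉S)
                         , (λ z∈⁅b⁆ → z∈⁅b⁆) ] (x∈p∪q⁻ _ _ z∈ab)

  ∣S∩endpointSet∣≤length : ∀ {S} M → Independent G S → All (λ e → Adj G (proj₁ e) (proj₂ e)) M →
                           ∣ S ∩ endpointSet M ∣ ≤ length M
  ∣S∩endpointSet∣≤length {S} []            _    []         = ≤-reflexive (Empty⇒∣p∣≡0 λ (_ , x∈) → ∉⊥ (p∩q⊆q S ⊥ x∈))
  ∣S∩endpointSet∣≤length {S} ((a , b) ∷ M) indS (ab ∷ M-adj) =
    ≤-trans (∣S∩endpointSet-∷∣ S a b M) (+-mono-≤ (∣S∩edge∣≤1 indS ab) (∣S∩endpointSet∣≤length M indS M-adj))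

  ∣S∩endpointSet-∷∣≤ : ∀ {S a b} M → a ∉ S → b ∉ S → ∣ S ∩ endpointSet ((a , b) ∷ M) ∣ ≤ ∣ S ∩ endpointSet M ∣
  ∣S∩endpointSet-∷∣≤ {S} {a} {b} M a∉S b∉S =
    ≤-trans (∣S∩endpointSet-∷∣ S a b M) (≤-reflexive (cong (_+ ∣ S ∩ endpointSet M ∣) (Empty⇒∣p∣≡0 S∩ab=∅)))
    where
    S∩ab=∅ : Empty (S ∩ (⁅ a ⁆ ∪ ⁅ b ⁆))
    S∩ab=∅ (z , z∈) with x∈p∩q⁻ S _ z∈
    ... | z∈S , z∈ab = [ (λ z∈⁅a⁆ → a∉S (subst (_∈ S) (x∈⁅y⁆⇒x≡y a z∈⁅a⁆) z∈S))
                       , (λ z∈⁅b⁆ → b∉S (subst (_∈ S) (x∈⁅y⁆⇒x≡y b z∈⁅b⁆) z∈S)) ] (x∈p∪q⁻ _ _ z∈ab)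

  private
    ordered-edge? : (e : V G × V G) → Dec (toℕ (proj₁ e) < toℕ (proj₂ e) × Adj G (proj₁ e) (proj₂ e))
    ordered-edge? (u , v) = toℕ u <? toℕ v ×-dec adj? G u v

    concatMap≡cartesianProduct : ∀ (xs ys : List (V G)) → concatMap (λ u → map (u ,_) ys) xs ≡ cartesianProduct xs ys
    concatMap≡cartesianProduct []       ys = refl
    concatMap≡cartesianProduct (x ∷ xs) ys = cong (map (x ,_) ys ++_) (concatMap≡cartesianProduct xs ys)

    allPairs : List (V G × V G)
    allPairs = concatMap (λ u → map (u ,_) (allFin (n G))) (allFin (n G))

  ∈edges⁻ : ∀ {e} → e ∈ₗ edges G → toℕ (proj₁ e) < toℕ (proj₂ e) × Adj G (proj₁ e) (proj₂ e)
  ∈edges⁻ e∈ = proj₂ (∈-filter⁻ ordered-edge? {xs = allPairs} e∈)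

  ∈edges⁺ : ∀ {u v} → toℕ u < toℕ v → Adj G u v → (u , v) ∈ₗ edges G
  ∈edges⁺ {u} {v} u<v uv = ∈-filter⁺ ordered-edge?
    (subst ((u , v) ∈ₗ_) (≡.sym (concatMap≡cartesianProduct (allFin (n G)) (allFin (n G)))) (∈-cartesianProduct⁺ (∈-allFin u) (∈-allFin v))) (u<v , uv)

  edges-unique : Unique (edges G)
  edges-unique = Unique.filter⁺ ordered-edge?
    (subst Unique (≡.sym (concatMap≡cartesianProduct (allFin (n G)) (allFin (n G)))) (Unique.cartesianProduct⁺ (Unique.allFin⁺ (n G)) (Unique.allFin⁺ (n G))))

  length≤μ : ∀ {M} → IsMatching G M → M ∈ₗ sublists G (edges G) → length M ≤ μ G
  length≤μ matching M∈ = ≤maxOf (∈-map⁺ length (∈-filter⁺ (isMatching? G) M∈ matching))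

  filter∈sublists : ∀ {A : Set} {P : A → Set} (P? : ∀ x → Dec (P x)) xs → filter P? xs ∈ₗ sublists G xs
  filter∈sublists P? []       = here refl
  filter∈sublists P? (x ∷ xs) with does (P? x)
  ... | false = ∈-++⁺ˡ (filter∈sublists P? xs)
  ... | true  = ∈-++⁺ʳ (sublists G xs) (∈-map⁺ (x ∷_) (filter∈sublists P? xs))

  module _ {X Y : VSet G} (sat : Saturating X Y) where


    private
      f = match sat

    Matched : V G × V G → Set
    Matched (u , v) = (u ∈ X × f u ≡ v) ⊎ (v ∈ X × f v ≡ u)

    matched? : ∀ e → Dec (Matched e)
    matched? (u , v) = (u ∈? X ×-dec f u ≟ v) ⊎-dec (v ∈? X ×-dec f v ≟ u)

    matchedEdges : List (V G × V G)
    matchedEdges = filter matched? (edges G)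

    matchedEdges-cover : ∀ {x} → x ∈ X → (x , f x) ∈ₗ matchedEdges ⊎ (f x , x) ∈ₗ matchedEdges
    matchedEdges-cover {x} x∈X with toℕ x <? toℕ (f x)
    ... | yes x<fx = inj₁ (∈-filter⁺ matched? (∈edges⁺ x<fx (match-adj sat x∈X)) (inj₁ (x∈X , refl)))
    ... | no  x≮fx = inj₂ (∈-filter⁺ matched? (∈edges⁺ fx<x (Adj-sym (match-adj sat x∈X))) (inj₂ (x∈X , refl)))
      where
      fx<x : toℕ (f x) < toℕ x
      fx<x = ≤∧≢⇒< (≮⇒≥ x≮fx) (Adj⇒≢ (Adj-sym (match-adj sat x∈X)) ∘ toℕ-injective)

    private
      ends : V G × V G → List (V G)
      ends e = proj₁ e ∷ proj₂ e ∷ []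

      centre : ∀ {e} → Matched e → ∃ λ x → x ∈ X × (e ≡ (x , f x) ⊎ e ≡ (f x , x))
      centre (inj₁ (u∈X , refl)) = _ , u∈X , inj₁ refl
      centre (inj₂ (v∈X , refl)) = _ , v∈X , inj₂ refl

      ∈ends : ∀ {e x v} → (e ≡ (x , f x) ⊎ e ≡ (f x , x)) → v ∈ₗ ends e → v ≡ x ⊎ v ≡ f x
      ∈ends (inj₁ refl) (here v≡x)          = inj₁ v≡x
      ∈ends (inj₁ refl) (there (here v≡fx)) = inj₂ v≡fx
      ∈ends (inj₂ refl) (here v≡fx)         = inj₂ v≡fx
      ∈ends (inj₂ refl) (there (here v≡x))  = inj₁ v≡x

      ordered-unique : ∀ {e e′ x} → e ∈ₗ edges G → e′ ∈ₗ edges G →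
                       (e ≡ (x , f x) ⊎ e ≡ (f x , x)) → (e′ ≡ (x , f x) ⊎ e′ ≡ (f x , x)) → e ≡ e′
      ordered-unique _  _   (inj₁ refl) (inj₁ refl) = refl
      ordered-unique _  _   (inj₂ refl) (inj₂ refl) = refl
      ordered-unique e∈ e′∈ (inj₁ refl) (inj₂ refl) = contradiction (proj₁ (∈edges⁻ e∈)) (<⇒≯ (proj₁ (∈edges⁻ e′∈)))
      ordered-unique e∈ e′∈ (inj₂ refl) (inj₁ refl) = contradiction (proj₁ (∈edges⁻ e∈)) (<⇒≯ (proj₁ (∈edges⁻ e′∈)))

      same-centre : Disjoint G X Y → ∀ {v x x′} → x ∈ X → x′ ∈ X → v ≡ x ⊎ v ≡ f x → v ≡ x′ ⊎ v ≡ f x′ → x ≡ x′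
      same-centre _      _   _    (inj₁ refl) (inj₁ v≡x′)  = v≡x′
      same-centre X∩Y=∅ x∈X x′∈X (inj₁ refl) (inj₂ v≡fx′) = contradiction (subst (_∈ Y) (≡.sym v≡fx′) (match-∈ sat x′∈X)) (X∩Y=∅ _ x∈X)
      same-centre X∩Y=∅ x∈X x′∈X (inj₂ v≡fx) (inj₁ refl)  = contradiction (subst (_∈ Y) (≡.sym v≡fx) (match-∈ sat x∈X)) (X∩Y=∅ _ x′∈X)
      same-centre _      x∈X x′∈X (inj₂ v≡fx) (inj₂ v≡fx′) = match-injective sat x∈X x′∈X (≡.trans (≡.sym v≡fx) v≡fx′)

    matchedEdges-isMatching : Disjoint G X Y → IsMatching G matchedEdges
    matchedEdges-isMatching X∩Y=∅ = all-adj , Unique.concat⁺ (All.map⁺ (All.map ends-unique all-adj)) (AllPairs.map⁺ pairwise-disjoint)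
      where
      all-adj : All (λ e → Adj G (proj₁ e) (proj₂ e)) matchedEdges
      all-adj = All.tabulate λ e∈ → proj₂ (∈edges⁻ (proj₁ (∈-filter⁻ matched? {xs = edges G} e∈)))
      ends-unique : ∀ {e} → Adj G (proj₁ e) (proj₂ e) → Unique (ends e)
      ends-unique uv = (Adj⇒≢ uv ∷ []) ∷ [] ∷ []
      distinct⇒disjoint-ends : ∀ {e e′} → e ∈ₗ edges G × Matched e → e′ ∈ₗ edges G × Matched e′ → e ≢ e′ → ListDisjoint (ends e) (ends e′)
      distinct⇒disjoint-ends (e∈ , m) (e′∈ , m′) e≢e′ (v∈e , v∈e′) with centre m | centre m′
      ... | x , x∈X , e≡ | x′ , x′∈X , e′≡ with same-centre X∩Y=∅ x∈X x′∈X (∈ends e≡ v∈e) (∈ends e′≡ v∈e′)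
      ...   | refl = e≢e′ (ordered-unique e∈ e′∈ e≡ e′≡)
      pairwise-disjoint : AllPairs (λ e e′ → ListDisjoint (ends e) (ends e′)) matchedEdges
      pairwise-disjoint = AllPairs-with (Unique.filter⁺ matched? edges-unique)
                            (All.tabulate (∈-filter⁻ matched? {xs = edges G})) distinct⇒disjoint-ends

  ∣X∣≤length-matchedEdges : ∀ {X Y} → Independent G X → Disjoint G X Y → (sat : Saturating X Y) →
                            ∣ X ∣ ≤ length (matchedEdges sat)
  ∣X∣≤length-matchedEdges {X} indX X∩Y=∅ sat = ≤-trans (p⊆q⇒∣p∣≤∣q∣ X⊆) (∣S∩endpointSet∣≤length _ indX (proj₁ (matchedEdges-isMatching sat X∩Y=∅)))
    where
    X⊆ : X ⊆ X ∩ endpointSet (matchedEdges sat)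
    X⊆ x∈X = x∈p∩q⁺ (x∈X , [ proj₁ ∘ ∈endpointSet⁺ , proj₂ ∘ ∈endpointSet⁺ ] (matchedEdges-cover sat x∈X))

  private
    ∣S─E∣+2len≡ : ∀ {M} S → IsMatching G M → ∣ (S ─ endpointSet M) ∪ endpointSet M ∣ ≡ ∣ S ─ endpointSet M ∣ + (length M + length M)
    ∣S─E∣+2len≡ {M} S (_ , M-unique) = ≡.trans (∣p∪q∣≡∣p∣+∣q∣ _ _ λ x x∈ → x∈p─q⇒x∉q S (endpointSet M) x∈)
                                              (cong (∣ S ─ endpointSet M ∣ +_) (∣endpointSet∣ M M-unique))

    ∣S∣≤ : ∀ {M} S → Independent G S → IsMatching G M → ∣ S ∣ ≤ length M + ∣ S ─ endpointSet M ∣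
    ∣S∣≤ {M} S indS (M-adj , _) = ≤-trans (≤-reflexive (∣p∣≡∣p∩q∣+∣p─q∣ S (endpointSet M)))
                                          (+-monoˡ-≤ _ (∣S∩endpointSet∣≤length M indS M-adj))

  -- S ∈ Ω meets each edge of M at most once, and a vertex outside S and the matched vertices remains.
  α+length+1≤n-uncovered : ∀ {S M v} → Ω G S → IsMatching G M → v ∉ S → v ∉ endpointSet M → α G + length M + 1 ≤ n G
  α+length+1≤n-uncovered {S} {M} {v} (indS , ∣S∣≡α) matching v∉S v∉E = begin
    α G + length M + 1                            ≤⟨ +-monoˡ-≤ 1 (+-monoˡ-≤ (length M) (≤-trans (≤-reflexive (≡.sym ∣S∣≡α)) (∣S∣≤ S indS matching))) ⟩
    length M + ∣ S ─ endpointSet M ∣ + length M + 1 ≡⟨ rearrange (length M) ∣ S ─ endpointSet M ∣ ⟩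
    suc (∣ S ─ endpointSet M ∣ + (length M + length M)) ≡⟨ cong suc (∣S─E∣+2len≡ S matching) ⟨
    suc ∣ (S ─ endpointSet M) ∪ endpointSet M ∣     ≤⟨ x∉p⇒∣p∣<n ((S ─ endpointSet M) ∪ endpointSet M) v∉ ⟩
    n G                                           ∎
    where
    open ≤-Reasoning
    rearrange : ∀ l s → l + s + l + 1 ≡ suc (s + (l + l))
    rearrange = solve-∀
    v∉ : v ∉ (S ─ endpointSet M) ∪ endpointSet M
    v∉ v∈ = [ v∉S ∘ p─q⊆p S (endpointSet M) , v∉E ] (x∈p∪q⁻ (S ─ endpointSet M) (endpointSet M) v∈)

  -- If S ∈ Ω avoids both ends of an edge of M, it meets the other edges at most once each.
  α+length+1≤n-avoided : ∀ {S a b M} → Ω G S → IsMatching G ((a , b) ∷ M) → a ∉ S → b ∉ S →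
                         α G + length ((a , b) ∷ M) + 1 ≤ n G
  α+length+1≤n-avoided {S} {a} {b} {M} (indS , ∣S∣≡α) matching@(_ ∷ M-adj , _) a∉S b∉S = begin
    α G + suc (length M) + 1                        ≤⟨ +-monoˡ-≤ 1 (+-monoˡ-≤ (suc (length M)) α≤) ⟩
    length M + ∣ S ─ E ∣ + suc (length M) + 1       ≡⟨ rearrange (length M) ∣ S ─ E ∣ ⟩
    ∣ S ─ E ∣ + (suc (length M) + suc (length M))   ≡⟨ ∣S─E∣+2len≡ S matching ⟨
    ∣ (S ─ E) ∪ E ∣                                 ≤⟨ ∣p∣≤n ((S ─ E) ∪ E) ⟩
    n G                                             ∎
    where
    open ≤-Reasoning
    E = endpointSet ((a , b) ∷ M)
    rearrange : ∀ l s → l + s + suc l + 1 ≡ s + (suc l + suc l)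
    rearrange = solve-∀
    α≤ : α G ≤ length M + ∣ S ─ E ∣
    α≤ = begin
      α G                                   ≡⟨ ∣S∣≡α ⟨
      ∣ S ∣                                 ≡⟨ ∣p∣≡∣p∩q∣+∣p─q∣ S E ⟩
      ∣ S ∩ E ∣ + ∣ S ─ E ∣                 ≤⟨ +-monoˡ-≤ ∣ S ─ E ∣ (∣S∩endpointSet-∷∣≤ M a∉S b∉S) ⟩
      ∣ S ∩ endpointSet M ∣ + ∣ S ─ E ∣     ≤⟨ +-monoˡ-≤ ∣ S ─ E ∣ (∣S∩endpointSet∣≤length M indS M-adj) ⟩
      length M + ∣ S ─ E ∣                  ∎

  +μ≤ : ∀ {k b} → (∀ M → IsMatching G M → k + length M ≤ b) → k + μ G ≤ b
  +μ≤ {k} {b} bounded = begin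
    k + μ G         ≤⟨ +-monoʳ-≤ k (maxOf≤ _ length≤) ⟩
    k + (b ∸ k)     ≡⟨ m+[n∸m]≡n (≤-trans (≤-reflexive (≡.sym (+-identityʳ k))) (bounded [] ([] , []))) ⟩
    b               ∎
    where
    open ≤-Reasoning
    length≤ : ∀ {ℓ} → ℓ ∈ₗ map length (filter (isMatching? G) (sublists G (edges G))) → ℓ ≤ b ∸ k
    length≤ ℓ∈ with ∈-map⁻ length ℓ∈
    ... | M , M∈ , refl = m+n≤o⇒m≤o∸n (length M) (≤-trans (≤-reflexive (+-comm (length M) k))
                            (bounded M (proj₂ (∈-filter⁻ (isMatching? G) {xs = sublists G (edges G)} M∈))))

  -- Neighbour permutations and regularizability

  record NeighbourPermutation : Set where
    field
      σ           : V G → V G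
      σ-adj       : ∀ v → Adj G v (σ v)
      σ-injective : Injective _≡_ _≡_ σ

  open NeighbourPermutation

  private
    -- Each neighbour permutation, as a 0/1 matrix plus its transpose, is a symmetric matrix supported on
    -- edges with all row sums 2.
    weight : NeighbourPermutation → V G → V G → ℕ
    weight π u v = 𝟙[ σ π u ≟ v ] + 𝟙[ σ π v ≟ u ]

    weight-sym : ∀ π u v → weight π u v ≡ weight π v u
    weight-sym π u v = +-comm 𝟙[ σ π u ≟ v ] 𝟙[ σ π v ≟ u ]

    weight-non-edge : ∀ π {u v} → ¬ Adj G u v → weight π u v ≡ 0
    weight-non-edge π {u} {v} u≁v with σ π u ≟ v | σ π v ≟ u
    ... | yes refl | _        = contradiction (σ-adj π u) u≁v
    ... | no _     | yes refl = contradiction (Adj-sym (σ-adj π v)) u≁v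
    ... | no _     | no _     = refl

    weight-row : ∀ π u → sum (map (weight π u) (allFin (n G))) ≡ 2
    weight-row π u = begin
      sum (map (weight π u) (allFin (n G)))                                              ≡⟨ sum-map-+ _ _ (allFin (n G)) ⟩
      sum (map (λ v → 𝟙[ σ π u ≟ v ]) (allFin (n G))) + sum (map (λ v → 𝟙[ σ π v ≟ u ]) (allFin (n G))) ≡⟨ cong₂ _+_ row column ⟩
      2                                                                                  ∎
      where
      open ≡-Reasoning
      row : sum (map (λ v → 𝟙[ σ π u ≟ v ]) (allFin (n G))) ≡ 1
      row = sum-𝟙-unique (λ v → σ π u ≟ v) (allFin (n G)) (Unique.allFin⁺ (n G)) (∈-allFin (σ π u)) refl ≡.sym
      column : sum (map (λ v → 𝟙[ σ π v ≟ u ]) (allFin (n G))) ≡ 1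
      column = let v₀ , σv₀≡u = injective⇒surjective (σ-injective π) u in
        sum-𝟙-unique (λ v → σ π v ≟ u) (allFin (n G)) (Unique.allFin⁺ (n G)) (∈-allFin v₀) σv₀≡u
          (λ σv≡u → σ-injective π (≡.trans σv≡u (≡.sym σv₀≡u)))

  regularizable : (Π : List NeighbourPermutation) → (∀ {u v} → Adj G u v → ∃ λ π → π ∈ₗ Π × σ π u ≡ v) →
                  ∀ {u₀ v₀} → Adj G u₀ v₀ → Regularizable G
  regularizable Π covered u₀v₀ = w , w-sym , w-edge , w-non-edge , sum (map (λ _ → 2) Π) , d≥1 , w-degree
    where
    w : V G → V G → ℕ
    w u v = sum (map (λ π → weight π u v) Π)
    w-sym : ∀ u v → w u v ≡ w v u
    w-sym u v = cong sum (map-cong (λ π → weight-sym π u v) Π)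
    w-edge : ∀ u v → Adj G u v → 1 ≤ w u v
    w-edge u v uv with covered uv
    ... | π , π∈Π , σu≡v = ≤-trans (≤-trans (≤-reflexive (≡.sym 𝟙≡1)) (m≤m+n _ _)) (∈⇒≤sum-map (λ π → weight π u v) π∈Π)
      where
      𝟙≡1 : 𝟙[ σ π u ≟ v ] ≡ 1
      𝟙≡1 with σ π u ≟ v
      ... | yes _   = refl
      ... | no  σu≢v = contradiction σu≡v σu≢v
    w-non-edge : ∀ u v → ¬ Adj G u v → w u v ≡ 0
    w-non-edge u v u≁v = ≡.trans (cong sum (map-cong (λ π → weight-non-edge π u≁v) Π)) (sum-map-0 Π)
    d≥1 : 1 ≤ sum (map (λ _ → 2) Π)
    d≥1 = let π , π∈Π , _ = covered u₀v₀ in ≤-trans (s≤s z≤n) (∈⇒≤sum-map (λ _ → 2) π∈Π)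
    w-degree : ∀ u → sum (map (w u) (allFin (n G))) ≡ sum (map (λ _ → 2) Π)
    w-degree u = ≡.trans (sum-map-comm (λ v π → weight π u v) (allFin (n G)) Π)
                         (cong sum (map-cong (λ π → weight-row π u) Π))

  module _ (expands : ∀ B → Independent G B → Nonempty B → ∣ B ∣ < ∣ N G B ∣) where

    private
      ∣S∣<∣NS∣-isolated : ∀ S → Nonempty (S ─ N G S) → ∣ S ∣ < ∣ N G S ∣
      ∣S∣<∣NS∣-isolated S isolated = begin-strict
        ∣ S ∣                          ≡⟨ ∣p∣≡∣p∩q∣+∣p─q∣ S (N G S) ⟩
        ∣ S ∩ N G S ∣ + ∣ S₀ ∣         <⟨ +-monoʳ-< ∣ S ∩ N G S ∣ (expands S₀ S₀-independent isolated) ⟩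
        ∣ S ∩ N G S ∣ + ∣ N G S₀ ∣     ≡⟨ ∣p∪q∣≡∣p∣+∣q∣ (S ∩ N G S) (N G S₀) disjoint ⟨
        ∣ (S ∩ N G S) ∪ N G S₀ ∣       ≤⟨ p⊆q⇒∣p∣≤∣q∣ ⊆NS ⟩
        ∣ N G S ∣                      ∎
        where
        open ≤-Reasoning
        S₀ = S ─ N G S
        S₀-independent : Independent G S₀
        S₀-independent u v u∈ v∈ uv = x∈p─q⇒x∉q S (N G S) u∈ (∈N⁺ S (p─q⊆p S (N G S) v∈) uv)
        disjoint : Disjoint G (S ∩ N G S) (N G S₀)
        disjoint z z∈S∩NS z∈NS₀ with ∈N⁻ S₀ z∈NS₀
        ... | a , a∈S₀ , za = x∈p─q⇒x∉q S (N G S) a∈S₀ (∈N⁺ S (p∩q⊆p S (N G S) z∈S∩NS) (Adj-sym za))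
        ⊆NS : (S ∩ N G S) ∪ N G S₀ ⊆ N G S
        ⊆NS z∈ = [ p∩q⊆q S (N G S) , N-mono (p─q⊆p S (N G S)) ] (x∈p∪q⁻ _ _ z∈)

    -- A nonempty S ⊆ N(S) either has a neighbour outside itself or, by connectivity, is all of V.
    ∣S∣<∣NS∣ : (∀ u v → Reach G u v) → ∀ S {x} → Nonempty S → x ∉ S → ∣ S ∣ < ∣ N G S ∣
    ∣S∣<∣NS∣ reach S {x} (s , s∈S) x∉S with nonempty? (S ─ N G S)
    ... | yes isolated = ∣S∣<∣NS∣-isolated S isolated
    ... | no  no-isolated with any? (λ z → z ∈? N G S ×-dec ¬? (z ∈? S))
    ...   | yes (z , z∈NS , z∉S) = begin-strict
      ∣ S ∣           <⟨ n<1+n _ ⟩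
      suc ∣ S ∣       ≡⟨ x∉p⇒∣p∪⁅x⁆∣≡1+∣p∣ S z∉S ⟨
      ∣ S ∪ ⁅ z ⁆ ∣   ≤⟨ p⊆q⇒∣p∣≤∣q∣ ⊆NS ⟩
      ∣ N G S ∣       ∎
      where
      open ≤-Reasoning
      ⊆NS : S ∪ ⁅ z ⁆ ⊆ N G S
      ⊆NS {w} w∈ with x∈p∪q⁻ S ⁅ z ⁆ w∈ | w ∈? N G S
      ... | _            | yes w∈NS = w∈NS
      ... | inj₁ w∈S     | no  w∉NS = contradiction (w , x∈p∧x∉q⇒x∈p─q w∈S w∉NS) no-isolated
      ... | inj₂ w∈⁅z⁆   | no  w∉NS = contradiction (subst (_∈ N G S) (≡.sym (x∈⁅y⁆⇒x≡y z w∈⁅z⁆)) z∈NS) w∉NS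
    ...   | no  closed = contradiction (Reach-closed (_∈ S) S-closed (reach s x) s∈S) x∉S
      where
      S-closed : ∀ {a b} → a ∈ S → Adj G a b → b ∈ S
      S-closed {a} {b} a∈S ab with b ∈? S
      ... | yes b∈S = b∈S
      ... | no  b∉S = contradiction (b , ∈N⁺ S a∈S (Adj-sym ab) , b∉S) closed

    neighbourPermutation-through : (∀ u v → Reach G u v) → ∀ {x y} → Adj G x y → Σ NeighbourPermutation λ π → σ π x ≡ y
    neighbourPermutation-through reach {x} {y} xy = π , glue-∈ (x∈⁅x⁆ x)
      where
      hallCondition : HallCondition (∁ ⁅ x ⁆) (∁ ⁅ y ⁆)
      hallCondition S S⊆ with nonempty? S
      ... | no  empty    = ≤-trans (≤-reflexive (Empty⇒∣p∣≡0 empty)) z≤n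
      ... | yes nonempty = ≤-pred (≤-trans (∣S∣<∣NS∣ reach S nonempty (λ x∈S → x∈∁p⇒x∉p (S⊆ x∈S) (x∈⁅x⁆ x)))
                                           (p⊆q∪⁅x⁆⇒∣p∣≤1+∣q∣ split))
        where
        split : N G S ⊆ (N G S ∩ ∁ ⁅ y ⁆) ∪ ⁅ y ⁆
        split {z} z∈NS with z ≟ y
        ... | yes refl = x∈p∪q⁺ (inj₂ (x∈⁅x⁆ y))
        ... | no  z≢y  = x∈p∪q⁺ (inj₁ (x∈p∩q⁺ (z∈NS , x∉p⇒x∈∁p (z≢y ∘ x∈⁅y⁆⇒x≡y y))))
      sat : Saturating ⊤ ⊤
      sat = Saturating-weaken (⊆-reflexive (≡.sym (p∪∁p≡⊤ ⁅ x ⁆))) (λ _ → ∈⊤)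
              (Saturating-∪ (λ z z∈⁅y⁆ → x∈p⇒x∉∁p z∈⁅y⁆) (Saturating-⁅⁆ xy) (hall (∁ ⁅ x ⁆) (∁ ⁅ y ⁆) hallCondition))
      π : NeighbourPermutation
      π = record { σ = match sat ; σ-adj = λ v → match-adj sat ∈⊤ ; σ-injective = match-injective sat ∈⊤ ∈⊤ }

module W₂-Properties (G : Graph) (w₂ : W₂ G) where

  two-disjoint-Ω : Σ (VSet G) λ T₁ → Σ (VSet G) λ T₂ → Ω G T₁ × Ω G T₂ × Disjoint G T₁ T₂
  two-disjoint-Ω with w₂ ⊥ ⊥ (Independent-⊥ G) (Independent-⊥ G) (λ _ _ → ∉⊥)
  ... | T₁ , T₂ , ΩT₁ , ΩT₂ , _ , _ , T₁∩T₂=∅ = T₁ , T₂ , ΩT₁ , ΩT₂ , T₁∩T₂=∅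

  Ω-disjoint-from : ∀ {S} → Independent G S → ∃ λ T → Ω G T × Disjoint G S T
  Ω-disjoint-from {S} indS with w₂ S ⊥ indS (Independent-⊥ G) (λ _ _ → ∉⊥)
  ... | T₁ , T₂ , _ , ΩT₂ , S⊆T₁ , _ , T₁∩T₂=∅ = T₂ , ΩT₂ , λ x x∈S → T₁∩T₂=∅ x (S⊆T₁ x∈S)

  α≡αOn∁ : ∀ {S} → Independent G S → α G ≡ αOn G (∁ S)
  α≡αOn∁ {S} indS with Ω-disjoint-from indS
  ... | T , (indT , ∣T∣≡α) , S∩T=∅ = ≤-antisym
    (≤-trans (≤-reflexive (≡.sym ∣T∣≡α)) (∣S∣≤αOn G (∁ S) indT λ x∈T → x∉p⇒x∈∁p λ x∈S → S∩T=∅ _ x∈S x∈T))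
    (αOn≤α G (∁ S))

  ∣A∣≤αOnN : ∀ {A} → Independent G A → ∣ A ∣ ≤ αOn G (N G A)
  ∣A∣≤αOnN {A} indA with Ω-disjoint-from indA
  ... | T , ΩT , A∩T=∅ = ≤-trans (∣S∣≤∣NS∩T∣ G indA ΩT A∩T=∅)
    (∣S∣≤αOn G (N G A) (Independent-⊆ G (p∩q⊆q (N G A) T) (proj₁ ΩT)) (p∩q⊆p (N G A) T))

  saturating-Ω : ∀ {A} → Independent G A → ∃ λ T → Ω G T × Disjoint G A T × Saturating G A T
  saturating-Ω {A} indA with Ω-disjoint-from indA
  ... | T , ΩT , A∩T=∅ = T , ΩT , A∩T=∅ , hall G A T (HallCondition-Ω G indA ΩT A∩T=∅)

  -- The new neighbours N(B ─ A) ∖ N(A) contain N(B ─ A) ∩ T₁ for a maximum T₁ ⊇ A disjoint from B ─ A.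
  ∂-mono : ∀ A B → A ⊆ B → Independent G B → ∂ G A ℤ.≤ ∂ G B
  ∂-mono A B A⊆B indB
    with w₂ A (B ─ A) (Independent-⊆ G A⊆B indB) (Independent-⊆ G (p─q⊆p B A) indB) (λ x x∈A x∈B─A → x∈p─q⇒x∉q B A x∈B─A x∈A)
  ... | T₁ , T₂ , ΩT₁ , _ , A⊆T₁ , B─A⊆T₂ , T₁∩T₂=∅ = ≡.subst₂ ℤ._≤_
    (cong (λ k → ℤ.+ k ℤ.- ℤ.+ ∣ A ∣) (≡.sym (∣p─q∣≡∣p∣ (N G A) A (Independent⇒Disjoint-N G indA))))
    (cong₂ (λ k l → ℤ.+ k ℤ.- ℤ.+ l) (≡.sym (∣p─q∣≡∣p∣ (N G B) B (Independent⇒Disjoint-N G indB))) (≡.sym ∣B∣≡∣A∣+∣B─A∣))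
    (m+d≤o⇒m-n≤o-[n+d] {n = ∣ A ∣} (∣ B ─ A ∣) grows)
    where
    indA = Independent-⊆ G A⊆B indB
    ∣B∣≡∣A∣+∣B─A∣ : ∣ B ∣ ≡ ∣ A ∣ + ∣ B ─ A ∣
    ∣B∣≡∣A∣+∣B─A∣ = ≡.trans (∣p∣≡∣p∩q∣+∣p─q∣ B A) (cong (_+ ∣ B ─ A ∣) (cong ∣_∣ (⊆-antisym (p∩q⊆q B A) λ x∈A → x∈p∩q⁺ (A⊆B x∈A , x∈A))))
    new-neighbours : N G (B ─ A) ∩ T₁ ⊆ N G B ─ N G A
    new-neighbours {x} x∈ with x∈p∩q⁻ _ _ x∈
    ... | x∈N , x∈T₁ = x∈p∧x∉q⇒x∈p─q (N-mono G (p─q⊆p B A) x∈N) λ x∈NA →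
      let a , a∈A , xa = ∈N⁻ G A x∈NA in proj₁ ΩT₁ x a x∈T₁ (A⊆T₁ a∈A) xa
    grows : ∣ N G A ∣ + ∣ B ─ A ∣ ≤ ∣ N G B ∣
    grows = begin
      ∣ N G A ∣ + ∣ B ─ A ∣                 ≤⟨ +-monoʳ-≤ ∣ N G A ∣ (∣S∣≤∣NS∩T∣ G (Independent-⊆ G (p─q⊆p B A) indB) ΩT₁ B─A∩T₁=∅) ⟩
      ∣ N G A ∣ + ∣ N G (B ─ A) ∩ T₁ ∣      ≤⟨ +-monoʳ-≤ ∣ N G A ∣ (p⊆q⇒∣p∣≤∣q∣ new-neighbours) ⟩
      ∣ N G A ∣ + ∣ N G B ─ N G A ∣         ≡⟨ cong (_+ ∣ N G B ─ N G A ∣) (cong ∣_∣ (⊆-antisym (λ x∈NA → x∈p∩q⁺ (N-mono G A⊆B x∈NA , x∈NA)) (p∩q⊆q _ _))) ⟩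
      ∣ N G B ∩ N G A ∣ + ∣ N G B ─ N G A ∣ ≡⟨ ∣p∣≡∣p∩q∣+∣p─q∣ (N G B) (N G A) ⟨
      ∣ N G B ∣                             ∎
      where
      open ≤-Reasoning
      B─A∩T₁=∅ : Disjoint G (B ─ A) T₁
      B─A∩T₁=∅ x x∈B─A x∈T₁ = T₁∩T₂=∅ x x∈T₁ (B─A⊆T₂ x∈B─A)

  α≤μ : α G ≤ μ G
  α≤μ with two-disjoint-Ω
  ... | A , _ , (indA , ∣A∣≡α) , _ with saturating-Ω indA
  ...   | T , _ , A∩T=∅ , sat = begin
    α G                          ≡⟨ ∣A∣≡α ⟨
    ∣ A ∣                        ≤⟨ ∣X∣≤length-matchedEdges G indA A∩T=∅ sat ⟩
    length (matchedEdges G sat)  ≤⟨ length≤μ G (matchedEdges-isMatching G sat A∩T=∅) (filter∈sublists G (matched? G sat) (edges G)) ⟩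
    μ G                          ∎
    where open ≤-Reasoning

  independent-matched : ∀ A → Independent G A → Σ (VSet G) λ T → Σ (List (V G × V G)) λ M →
    Independent G T × IsMatching G M × (∀ a → a ∈ A → Σ (V G) λ t → t ∈ T × ((a , t) ∈ₗ M ⊎ (t , a) ∈ₗ M))
  independent-matched A indA with saturating-Ω indA
  ... | T , (indT , _) , A∩T=∅ , sat = T , matchedEdges G sat , indT , matchedEdges-isMatching G sat A∩T=∅ ,
    λ a a∈A → Saturating.match sat a , Saturating.match-∈ sat a∈A , matchedEdges-cover G sat a∈A

  -- If w is the only neighbour of v, then a maximum set containing u but not w extends by v.
  leaf-neighbourhood : ∀ {v w u} → (∀ {b} → Adj G v b → b ≡ w) → u ≢ v → ¬ Adj G w u
  leaf-neighbourhood {v} {w} {u} only-w u≢v wu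
    with w₂ ⁅ v ⁆ ⁅ u ⁆ (Independent-⁅⁆ G v) (Independent-⁅⁆ G u) (λ x x∈⁅v⁆ x∈⁅u⁆ → u≢v (≡.trans (≡.sym (x∈⁅y⁆⇒x≡y u x∈⁅u⁆)) (x∈⁅y⁆⇒x≡y v x∈⁅v⁆)))
  ... | T₁ , T₂ , _ , (indT₂ , ∣T₂∣≡α) , v∈T₁ , u∈T₂ , T₁∩T₂=∅ with w ∈? T₂
  ...   | yes w∈T₂ = indT₂ w u w∈T₂ (u∈T₂ (x∈⁅x⁆ u)) wu
  ...   | no  w∉T₂ = 1+n≰n (begin
    suc (α G)       ≡⟨ cong suc ∣T₂∣≡α ⟨
    suc ∣ T₂ ∣      ≡⟨ x∉p⇒∣p∪⁅x⁆∣≡1+∣p∣ T₂ (T₁∩T₂=∅ v (v∈T₁ (x∈⁅x⁆ v))) ⟨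
    ∣ T₂ ∪ ⁅ v ⁆ ∣   ≤⟨ ∣S∣≤α G (Independent-∪ G T₂ ⁅ v ⁆ indT₂ (Independent-⁅⁆ G v) T₂≁v) ⟩
    α G             ∎)
    where
    open ≤-Reasoning
    T₂≁v : ∀ x y → x ∈ T₂ → y ∈ ⁅ v ⁆ → ¬ Adj G x y
    T₂≁v x y x∈T₂ y∈⁅v⁆ xy = w∉T₂ (subst (_∈ T₂) (only-w (Adj-sym G (subst (Adj G x) (x∈⁅y⁆⇒x≡y v y∈⁅v⁆) xy))) x∈T₂)

module Connected-W₂-Properties (G : Graph) (connected : Connected G) (not-K₂ : ¬ IsK₂ G) (w₂ : W₂ G) where

  open W₂-Properties G w₂

  private
    v₀ : V G
    v₀ = fromℕ< (proj₁ connected)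

    reach : ∀ u v → Reach G u v
    reach = proj₂ connected

  Ω-nonempty : ∀ {T} → Ω G T → Nonempty T
  Ω-nonempty {T} (_ , ∣T∣≡α) = ∣p∣>0⇒Nonempty T (≤-trans (≤-trans (≤-reflexive (≡.sym (∣⁅x⁆∣≡1 v₀))) (∣S∣≤α G (Independent-⁅⁆ G v₀)))
                                                           (≤-reflexive (≡.sym ∣T∣≡α)))

  another-vertex : ∀ v → ∃ λ u → u ≢ v
  another-vertex v with two-disjoint-Ω
  ... | T₁ , T₂ , ΩT₁ , ΩT₂ , T₁∩T₂=∅ with Ω-nonempty ΩT₁ | Ω-nonempty ΩT₂ | proj₁ (Ω-nonempty ΩT₁) ≟ v
  ...   | t₁ , t₁∈T₁ | t₂ , t₂∈T₂ | yes refl = t₂ , λ { refl → T₁∩T₂=∅ t₂ t₁∈T₁ t₂∈T₂ }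
  ...   | t₁ , _     | _          | no t₁≢v = t₁ , t₁≢v

  a-neighbour : ∀ v → ∃ (Adj G v)
  a-neighbour v with another-vertex v
  ... | u , u≢v with reach v u
  ...   | here             = contradiction refl u≢v
  ...   | step {v = w} vw _ = w , vw

  two-neighbours : ∀ v → Σ (V G) λ w₁ → Σ (V G) λ w₂ → w₁ ≢ w₂ × Adj G v w₁ × Adj G v w₂
  two-neighbours v with a-neighbour v
  ... | w , vw with any? (λ b → adj? G v b ×-dec ¬? (b ≟ w))
  ...   | yes (b , vb , b≢w) = w , b , b≢w ∘ ≡.sym , vw , vb
  ...   | no  only-w = contradiction (v , w , Adj⇒≢ G vw , vw , λ u → Reach-closed G (λ x → x ≡ v ⊎ x ≡ w) closed (reach v u) (inj₁ refl)) not-K₂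
    where
    neighbour≡w : ∀ {b} → Adj G v b → b ≡ w
    neighbour≡w {b} vb with b ≟ w
    ... | yes b≡w = b≡w
    ... | no  b≢w = contradiction (b , vb , b≢w) only-w
    closed : ∀ {a b} → a ≡ v ⊎ a ≡ w → Adj G a b → b ≡ v ⊎ b ≡ w
    closed (inj₁ refl) vb = inj₂ (neighbour≡w vb)
    closed {b = b} (inj₂ refl) wb with b ≟ v
    ... | yes b≡v = inj₁ b≡v
    ... | no  b≢v = contradiction wb (leaf-neighbourhood neighbour≡w b≢v)

  Ω-pair-avoiding : ∀ v → Σ (VSet G) λ S₁ → Σ (VSet G) λ S₂ → Ω G S₁ × Ω G S₂ × Disjoint G S₁ S₂ × v ∉ S₁ × v ∉ S₂
  Ω-pair-avoiding v with two-neighbours v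
  ... | w₁ , w₂′ , w₁≢w₂ , vw₁ , vw₂
    with w₂ ⁅ w₁ ⁆ ⁅ w₂′ ⁆ (Independent-⁅⁆ G w₁) (Independent-⁅⁆ G w₂′)
            (λ x x∈₁ x∈₂ → w₁≢w₂ (≡.trans (≡.sym (x∈⁅y⁆⇒x≡y w₁ x∈₁)) (x∈⁅y⁆⇒x≡y w₂′ x∈₂)))
  ...   | S₁ , S₂ , ΩS₁ , ΩS₂ , w₁∈S₁ , w₂∈S₂ , S₁∩S₂=∅ =
    S₁ , S₂ , ΩS₁ , ΩS₂ , S₁∩S₂=∅ ,
    (λ v∈S₁ → proj₁ ΩS₁ v w₁ v∈S₁ (w₁∈S₁ (x∈⁅x⁆ w₁)) vw₁) , (λ v∈S₂ → proj₁ ΩS₂ v w₂′ v∈S₂ (w₂∈S₂ (x∈⁅x⁆ w₂′)) vw₂)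

  2α+1≤n : 2 * α G + 1 ≤ n G
  2α+1≤n = let S₁ , S₂ , ΩS₁ , ΩS₂ , S₁∩S₂=∅ , v₀∉S₁ , v₀∉S₂ = Ω-pair-avoiding v₀ in disjoint-Ω-pair⇒2α+1≤n G ΩS₁ ΩS₂ S₁∩S₂=∅ v₀∉S₁ v₀∉S₂

  Ω-avoiding : ∀ u v → Σ (VSet G) λ S → Ω G S × u ∉ S × v ∉ S
  Ω-avoiding u v = let S₁ , S₂ , ΩS₁ , ΩS₂ , S₁∩S₂=∅ , u∉S₁ , u∉S₂ = Ω-pair-avoiding u in
    case v ∈? S₁ of λ where
      (yes v∈S₁) → S₂ , ΩS₂ , u∉S₂ , S₁∩S₂=∅ v v∈S₁
      (no  v∉S₁) → S₁ , ΩS₁ , u∉S₁ , v∉S₁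

  ∣B∣<∣NB∣ : ∀ B → Independent G B → Nonempty B → ∣ B ∣ < ∣ N G B ∣
  ∣B∣<∣NB∣ B indB (b , b∈B) = case any? (λ y → y ∈? N G B ×-dec any? (λ w → adj? G y w ×-dec ¬? (w ∈? B))) of λ where
      (yes (y , y∈NB , w , yw , w∉B)) →
        let T₁ , T₂ , _ , ΩT₂ , B⊆T₁ , w∈T₂ , T₁∩T₂=∅ =
              w₂ B ⁅ w ⁆ indB (Independent-⁅⁆ G w) (λ x x∈B x∈⁅w⁆ → w∉B (subst (_∈ B) (x∈⁅y⁆⇒x≡y w x∈⁅w⁆) x∈B))
        in ∣S∣<∣NS∣-via-Ω G indB ΩT₂ (λ x x∈B → T₁∩T₂=∅ x (B⊆T₁ x∈B)) y∈NB
             (λ y∈T₂ → proj₁ ΩT₂ y w y∈T₂ (w∈T₂ (x∈⁅x⁆ w)) yw)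
      (no closed) → contradiction (independent-cover⇒n≤2α G indB (indNB closed) (covered closed)) (<⇒≱ (≤-trans (≤-reflexive 2α+1≡) 2α+1≤n))
    where
    Escape : Set
    Escape = ∃ λ y → y ∈ N G B × ∃ λ w → Adj G y w × w ∉ B
    indNB : ¬ Escape → Independent G (N G B)
    indNB closed y y′ y∈NB y′∈NB yy′ with y′ ∈? B
    ... | yes y′∈B = Independent⇒Disjoint-N G indB y′ y′∈B y′∈NB
    ... | no  y′∉B = closed (y , y∈NB , y′ , yy′ , y′∉B)
    covered : ¬ Escape → ∀ v → v ∈ B ⊎ v ∈ N G B
    covered closed v = Reach-closed G (λ x → x ∈ B ⊎ x ∈ N G B) B∪NB-closed (reach b v) (inj₁ b∈B)
      where
      B∪NB-closed : ∀ {x z} → x ∈ B ⊎ x ∈ N G B → Adj G x z → z ∈ B ⊎ z ∈ N G B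
      B∪NB-closed (inj₁ x∈B) xz = inj₂ (∈N⁺ G B x∈B (Adj-sym G xz))
      B∪NB-closed {x} {z} (inj₂ x∈NB) xz with z ∈? B
      ... | yes z∈B = inj₁ z∈B
      ... | no  z∉B = contradiction (x , x∈NB , z , xz , z∉B) closed
    2α+1≡ : suc (α G + α G) ≡ 2 * α G + 1
    2α+1≡ = ≡.trans (cong (λ k → suc (α G + k)) (≡.sym (+-identityʳ (α G)))) (+-comm 1 (2 * α G))

  regularizable-W₂ : Regularizable G
  regularizable-W₂ = let w , v₀w = a-neighbour v₀ in regularizable G Π covered v₀w
    where
    through : ∀ {x y} → Adj G x y → Σ (NeighbourPermutation G) λ π → NeighbourPermutation.σ π x ≡ y
    through = neighbourPermutation-through G ∣B∣<∣NB∣ reach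
    -- for a non-edge xy any neighbour permutation will do
    π : V G × V G → NeighbourPermutation G
    π (x , y) with adj? G x y
    ... | yes xy = proj₁ (through xy)
    ... | no  _  = proj₁ (through (proj₂ (a-neighbour x)))
    Π : List (NeighbourPermutation G)
    Π = map π (cartesianProduct (allFin (n G)) (allFin (n G)))
    covered : ∀ {u v} → Adj G u v → ∃ λ π′ → π′ ∈ₗ Π × NeighbourPermutation.σ π′ u ≡ v
    covered {u} {v} uv = π (u , v) , ∈-map⁺ π (∈-cartesianProduct⁺ (∈-allFin u) (∈-allFin v)) , σu≡v
      where
      σu≡v : NeighbourPermutation.σ (π (u , v)) u ≡ v
      σu≡v with adj? G u v
      ... | yes uv′ = proj₂ (through uv′)
      ... | no  u≁v = contradiction uv u≁v

  α+μ≤n∸1 : α G + μ G ≤ n G ∸ 1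
  α+μ≤n∸1 = +μ≤ G λ M matching → m+n≤o⇒m≤o∸n (α G + length M) (α+length+1≤n M matching)
    where
    fully-matched : ∀ M → IsMatching G M → (∀ v → v ∈ endpointSet G M) → α G + length M + 1 ≤ n G
    fully-matched []             _        covered = contradiction (covered v₀) ∉⊥
    fully-matched ((a , b) ∷ M′) matching _       = let S , ΩS , a∉S , b∉S = Ω-avoiding a b in α+length+1≤n-avoided G ΩS matching a∉S b∉S
    α+length+1≤n : ∀ M → IsMatching G M → α G + length M + 1 ≤ n G
    α+length+1≤n M matching = case any? (λ v → ¬? (v ∈? endpointSet G M)) of λ where
      (yes (v , v∉E)) → let S , ΩS , v∉S , _ = Ω-avoiding v v in α+length+1≤n-uncovered G ΩS matching v∉S v∉E
      (no  covered)  → fully-matched M matching λ v → decidable-stable (v ∈? endpointSet G M) λ v∉E → covered (v , v∉E)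

theorem2p5 : (G : Graph) → Connected G → ¬ IsK₂ G → W₂ G →
    (∀ v → Σ (VSet G) λ S₁ → Σ (VSet G) λ S₂ →
       Ω G S₁ × Ω G S₂ × Disjoint G S₁ S₂ × v ∉ S₁ × v ∉ S₂)
    × (2 * α G + 1 ≤ n G)
    × (∀ u v → Σ (VSet G) λ S → Ω G S × u ∉ S × v ∉ S)
    × (α G ≤ μ G × α G + μ G ≤ n G ∸ 1)
    × (∀ S → Independent G S → α G ≡ αOn G (∁ S))
    × (∀ A B → A ⊆ B → Independent G B → ∂ G A ≤ℤ ∂ G B)
    × (Regularizable G × (∀ B → Independent G B → Nonempty B → ∣ B ∣ < ∣ N G B ∣))
    × (∀ A → Independent G A → ∣ A ∣ ≤ αOn G (N G A))
    × (∀ A → Independent G A → Σ (VSet G) λ T → Σ _ λ M →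
         Independent G T × IsMatching G M ×
         (∀ a → a ∈ A → Σ (V G) λ t → t ∈ T × ((a , t) ∈ₗ M ⊎ (t , a) ∈ₗ M)))
theorem2p5 G connected not-K₂ w₂ =
  Ω-pair-avoiding , 2α+1≤n , Ω-avoiding , (α≤μ , α+μ≤n∸1) , (λ _ → α≡αOn∁) , ∂-mono ,
  (regularizable-W₂ , ∣B∣<∣NB∣) , (λ _ → ∣A∣≤αOnN) , independent-matched
  where
  open W₂-Properties G w₂
  open Connected-W₂-Properties G connected not-K₂ w₂
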